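{- Let $n\ge1$ and $c\ge1$ be integers. For $0\le k\le n$, $$i_c(n,k)=\binom{n+k-1}{k}+\sum_{j\ge1}(-1)^j\binom{n+k-cu_j-cj-1}{k-cu_j-cj}+\sum_{j\ge1}(-1)^j\binom{n+k-cu_j-1}{k-cu_j},$$ where $u_j=j(3j-1)/2$ is the $j$-th generalized pentagonal number.
   Context: For integers $n\ge1$, $c\ge1$, let $G_{c,n}$ be the set of colored permutations: words $\sigma=\sigma_1^{[c_1]}\cdots\sigma_n^{[c_n]}$ where $|\sigma|=\sigma_1\cdots\sigma_n$ is a permutation of $[n]$ and each color $c_i\in\{0,\dots,c-1\}$. For a permutation $\pi$ of $[n]$, $\mathrm{inv}(\pi)=|\{(i,j):i<j,\ \pi_i>\pi_j\}|$. Let $\mathrm{col}(\sigma)=c_1+\cdots+c_n$ and $\mathrm{inv}_c(\sigma)=\mathrm{inv}(|\sigma|)+\mathrm{col}(\sigma)+c\cdot|\{(i,j):1\le i<j\le n,\ \sigma_i<\sigma_j,\ c_j\ne0\}|$. Define $i_c(n,k)=|\{\sigma\in G_{c,n}:\mathrm{inv}_c(\sigma)=k\}|$. Binomial coefficients $\binom{m}{r}$ with $r<0$ are $0$ (so the sums are finite). -}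

module Defs where

open import Data.Nat using (ℕ; zero; suc; _+_; _*_; _∸_; _<ᵇ_; _≤ᵇ_)
open import Data.Nat.Combinatorics using (_C_)
open import Data.Integer as ℤ using (ℤ; +_)
open import Data.Bool using (Bool; true; false; if_then_else_; _∧_; not)
open import Data.Fin using (Fin; toℕ)
open import Data.Vec using (Vec; []; _∷_; lookup)
open import Data.List using (List; []; _∷_; map; concatMap; filter; length; allFin; cartesianProduct; upTo; foldr)
open import Data.Product using (_×_; _,_; proj₁; proj₂)

allVec : {A : Set} → List A → (n : ℕ) → List (Vec A n)
allVec xs zero = [] ∷ []
allVec xs (suc n) = concatMap (λ x → map (x ∷_) (allVec xs n)) xs

countB : {A : Set} → (A → Bool) → List A → ℕ
countB p [] = 0
countB p (x ∷ xs) = (if p x then 1 else 0) + countB p xs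

allB : {A : Set} → (A → Bool) → List A → Bool
allB p [] = true
allB p (x ∷ xs) = p x ∧ allB p xs

pairs : (n : ℕ) → List (Fin n × Fin n)
pairs n = filterPairs (cartesianProduct (allFin n) (allFin n))
  where
  filterPairs : List (Fin n × Fin n) → List (Fin n × Fin n)
  filterPairs [] = []
  filterPairs ((i , j) ∷ ps) =
    if toℕ i <ᵇ toℕ j then (i , j) ∷ filterPairs ps else filterPairs ps

_<F_ : ∀ {n} → Fin n → Fin n → Bool
a <F b = toℕ a <ᵇ toℕ b

-- a word π₁…πₙ (values in Fin n, i.e. [n] shifted to 0-based) is a permutation
-- iff its entries are pairwise distinct
isPerm : ∀ {n} → Vec (Fin n) n → Bool
isPerm {n} π = allB (λ { (i , j) → not (toℕ (lookup π i) ≡ᵇ' toℕ (lookup π j)) }) (pairs n)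
  where
  _≡ᵇ'_ : ℕ → ℕ → Bool
  a ≡ᵇ' b = (a ≤ᵇ b) ∧ (b ≤ᵇ a)

permutations : (n : ℕ) → List (Vec (Fin n) n)
permutations n = filter' (allVec (allFin n) n)
  where
  filter' : List (Vec (Fin n) n) → List (Vec (Fin n) n)
  filter' [] = []
  filter' (π ∷ πs) = if isPerm π then π ∷ filter' πs else filter' πs

-- colored permutations G_{c,n}: pairs (|σ| , colors)
ColPerm : ℕ → ℕ → Set
ColPerm c n = Vec (Fin n) n × Vec (Fin c) n

coloredPerms : (c n : ℕ) → List (ColPerm c n)
coloredPerms c n = cartesianProduct (permutations n) (allVec (allFin c) n)

inv : ∀ {n} → Vec (Fin n) n → ℕ
inv {n} π = countB (λ { (i , j) → lookup π j <F lookup π i }) (pairs n)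

col : ∀ {c n} → Vec (Fin c) n → ℕ
col [] = 0
col (x ∷ xs) = toℕ x + col xs

invc : ∀ {c n} → ColPerm c n → ℕ
invc {c} {n} (π , cs) =
  inv π + col cs
  + c * countB (λ { (i , j) → (lookup π i <F lookup π j) ∧ (0 <ᵇ toℕ (lookup cs j)) }) (pairs n)

ic : (c n k : ℕ) → ℕ
ic c n k = countB (λ σ → eqℕ (invc σ) k) (coloredPerms c n)
  where
  eqℕ : ℕ → ℕ → Bool
  eqℕ a b = (a ≤ᵇ b) ∧ (b ≤ᵇ a)

-- generalized pentagonal number u_j = j(3j-1)/2 (exact division; j(3j-1) is even)
pent : ℕ → ℕ
pent j = (j * (3 * j ∸ 1)) Data.Nat./ 2
  where open import Data.Nat using (_/_)

-- binom(n + m - 1, m) for m = k - s, taken to be 0 when k - s < 0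
-- (so the top entry n+k-s-1 = (n-1)+(k-s) is ≥ 0 whenever the term is nonzero, as n ≥ 1)
shiftedBinom : (n k s : ℕ) → ℕ
shiftedBinom n k s = if s ≤ᵇ k then ((n ∸ 1) + (k ∸ s)) C (k ∸ s) else 0

sumFrom1 : ℕ → (ℕ → ℤ) → ℤ
sumFrom1 zero f = + 0
sumFrom1 (suc N) f = sumFrom1 N f ℤ.+ f (suc N)

sign : ℕ → ℤ
sign zero = + 1
sign (suc j) = ℤ.- sign j

-- right-hand side; the j-sums over j ≥ 1 are truncated at j = k + 1, which is harmless:
-- for j ≥ 1, u_j ≥ j, so every term with j > k has negative lower index and vanishes.
rhs : (c n k : ℕ) → ℤ
rhs c n k =
  + ((n + k ∸ 1) C k)
  ℤ.+ sumFrom1 (suc k) (λ j → sign j ℤ.* + shiftedBinom n k (c * pent j + c * j))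
  ℤ.+ sumFrom1 (suc k) (λ j → sign j ℤ.* + shiftedBinom n k (c * pent j))

-- Inserting the largest letter into a coloured permutation of [n] raises inv_c by an amount that runs
-- exactly once through 0, 1, …, c(n+1) − 1, so Σₖ i_c(n,k) xᵏ = ∏_{m=1}^{n} (1 − x^{cm}) / (1 − x).
-- With y = xᶜ, Shanks' finite form of Euler's pentagonal theorem
-- Σ_{k=0}^{N} (−1)ᵏ y^{Nk + k(k+1)/2} (1 − y^{k+1}) ⋯ (1 − y^N) = 1 + Σ_{j=1}^{N} (−1)ʲ (y^{u_j} + y^{u_j + j})
-- at N = n has (1 − y) ⋯ (1 − yⁿ) as its term k = 0, and all its other terms start in x-degree c(n + 1) > n.
-- So in degrees ≤ n the product equals the pentagonal sum, and dividing by (1 − x)ⁿ, whose coefficients are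
-- binomial(n + i − 1, i), gives the formula.

module Submission where

open import Defs
import Algebra.Properties.Semiring.Sum as FinSum
open import Data.Bool using (Bool; true; false; if_then_else_; _∧_; not)
open import Data.Bool.Properties using (if-float)
open import Data.Fin as Fin using (Fin; toℕ; punchIn; punchOut; inject₁; fromℕ; pinch)
import Data.Fin.Properties as Fin
open import Data.Integer as ℤ using (ℤ; +_)
import Data.Integer.Properties as ℤ
open import Data.Integer.Solver using (module +-*-Solver)
open import Data.List using (List; []; _∷_; _++_; map; concatMap; cartesianProduct; tabulate; allFin; filterᵇ)
open import Data.List.Membership.Propositional using (_∈_)
open import Data.List.Membership.Propositional.Properties
  using (∈-filter⁺; ∈-filter⁻; ∈-cartesianProduct⁺; ∈-allFin)
open import Data.List.Relation.Unary.Any using (here; there)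
open import Data.Nat as ℕ using (ℕ; zero; suc; _+_; _*_; _∸_; _≤_; _<_; _≤ᵇ_; _<ᵇ_; z≤n; s≤s; >-nonZero)
open import Data.Nat.Combinatorics using (_C_; nCk+nC[k+1]≡[n+1]C[k+1]; k>n⇒nCk≡0)
open import Data.Nat.DivMod using (_/_; m*n/n≡m; +-distrib-/-∣ʳ)
open import Data.Nat.Divisibility using (divides-refl)
open import Data.Nat.Properties hiding (_≟_)
import Data.Nat.Solver as ℕ-Solver
open import Data.Product using (_×_; _,_; proj₁; proj₂; uncurry)
open import Data.Product.Properties using (,-injective)
open import Data.Sum using (inj₁; inj₂)
open import Data.Vec as Vec using (Vec; []; _∷_; lookup; insertAt; removeAt)
import Data.Vec.Properties as Vec
open import Function using (_∘_; id)
open import Function.Bundles using (mk⇔)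
open import Function.Definitions using (Injective)
open import Relation.Binary.Definitions using (DecidableEquality; tri<; tri≈; tri>)
open import Relation.Binary.PropositionalEquality
open import Relation.Nullary using (does; map′; _×-dec_; yes; no; contradiction)
open import Relation.Nullary.Decidable using (does-⇔; dec-false; dec-true; T?)
open import Relation.Nullary.Reflects using (ofʸ; ofⁿ)

open import Algebra.Properties.CommutativeSemigroup +-commutativeSemigroup using (interchange; x∙yz≈y∙xz)
open FinSum +-*-semiring
  using (sum-syntax; ∑-distrib-+; sum-remove; sum-cong-≗; *-distribʳ-sum; sum-replicate-zero)
open +-*-Solver using (solve; _:+_; _:-_; _:*_; :-_; _:=_; con)
open ℕ-Solver.+-*-Solver using () renaming (solve to solveℕ; _:+_ to _⊕_; _:*_ to _⊛_; _:=_ to _⊜_; con to κ)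
open ≡-Reasoning

private
  variable
    A B : Set

-- Finite sums

sumℕ : ℕ → (ℕ → ℕ) → ℕ
sumℕ zero f = 0
sumℕ (suc m) f = sumℕ m f + f m

sumℕ-cong : ∀ m {f g : ℕ → ℕ} → (∀ e → e < m → f e ≡ g e) → sumℕ m f ≡ sumℕ m g
sumℕ-cong zero f≡g = refl
sumℕ-cong (suc m) f≡g = cong₂ _+_ (sumℕ-cong m (λ e e<m → f≡g e (m<n⇒m<1+n e<m))) (f≡g m ≤-refl)

sumℕ-+ : ∀ m (f g : ℕ → ℕ) → sumℕ m (λ e → f e + g e) ≡ sumℕ m f + sumℕ m g
sumℕ-+ zero f g = refl
sumℕ-+ (suc m) f g =
  trans (cong (_+ (f m + g m)) (sumℕ-+ m f g)) (interchange (sumℕ m f) (sumℕ m g) (f m) (g m))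

sumℕ-cons : ∀ m (f : ℕ → ℕ) → sumℕ (suc m) f ≡ f 0 + sumℕ m (f ∘ suc)
sumℕ-cons zero f = +-comm 0 (f 0)
sumℕ-cons (suc m) f = trans (cong (_+ f (suc m)) (sumℕ-cons m f)) (+-assoc (f 0) _ _)

sumℕ-split : ∀ a b (f : ℕ → ℕ) → sumℕ (a + b) f ≡ sumℕ a f + sumℕ b (λ e → f (a + e))
sumℕ-split a zero f = trans (cong (λ m → sumℕ m f) (+-identityʳ a)) (sym (+-identityʳ (sumℕ a f)))
sumℕ-split a (suc b) f = begin
  sumℕ (a + suc b) f                                ≡⟨ cong (λ m → sumℕ m f) (+-suc a b) ⟩
  sumℕ (a + b) f + f (a + b)                        ≡⟨ cong (_+ f (a + b)) (sumℕ-split a b f) ⟩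
  sumℕ a f + sumℕ b (λ e → f (a + e)) + f (a + b)   ≡⟨ +-assoc (sumℕ a f) _ _ ⟩
  sumℕ a f + sumℕ (suc b) (λ e → f (a + e))         ∎

sumℕ-reverse : ∀ n (f : ℕ → ℕ) → sumℕ (suc n) (λ e → f (n ∸ e)) ≡ sumℕ (suc n) f
sumℕ-reverse zero f = refl
sumℕ-reverse (suc n) f = begin
  sumℕ (suc (suc n)) (λ e → f (suc n ∸ e))    ≡⟨ sumℕ-cons (suc n) (λ e → f (suc n ∸ e)) ⟩
  f (suc n) + sumℕ (suc n) (λ e → f (n ∸ e))  ≡⟨ cong (_+_ (f (suc n))) (sumℕ-reverse n f) ⟩
  f (suc n) + sumℕ (suc n) f                  ≡⟨ +-comm (f (suc n)) _ ⟩
  sumℕ (suc (suc n)) f                        ∎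

sumℕ-blocks : ∀ N L (f : ℕ → ℕ) → sumℕ N (λ q → sumℕ L (λ r → f (r + L * q))) ≡ sumℕ (L * N) f
sumℕ-blocks zero L f = cong (λ m → sumℕ m f) (sym (*-zeroʳ L))
sumℕ-blocks (suc N) L f = begin
  sumℕ N (λ q → sumℕ L (λ r → f (r + L * q))) + sumℕ L (λ r → f (r + L * N))
    ≡⟨ cong₂ _+_ (sumℕ-blocks N L f) (sumℕ-cong L (λ r _ → cong f (+-comm r (L * N)))) ⟩
  sumℕ (L * N) f + sumℕ L (λ r → f (L * N + r))
    ≡⟨ sumℕ-split (L * N) L f ⟨
  sumℕ (L * N + L) f
    ≡⟨ cong (λ m → sumℕ m f) (trans (+-comm (L * N) L) (sym (*-suc L N))) ⟩
  sumℕ (L * suc N) f ∎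

sumℤ : ℕ → (ℕ → ℤ) → ℤ
sumℤ zero g = + 0
sumℤ (suc m) g = sumℤ m g ℤ.+ g m

sumℤ-cong : ∀ m {g h : ℕ → ℤ} → (∀ k → k < m → g k ≡ h k) → sumℤ m g ≡ sumℤ m h
sumℤ-cong zero g≡h = refl
sumℤ-cong (suc m) g≡h = cong₂ ℤ._+_ (sumℤ-cong m (λ k k<m → g≡h k (m<n⇒m<1+n k<m))) (g≡h m ≤-refl)

pos-sumℕ : ∀ m f → + sumℕ m f ≡ sumℤ m (+_ ∘ f)
pos-sumℕ zero f = refl
pos-sumℕ (suc m) f = trans (ℤ.pos-+ (sumℕ m f) (f m)) (cong (ℤ._+ + f m) (pos-sumℕ m f))

sumℤ-leading : ∀ N (g : ℕ → ℤ) → (∀ k → k < N → g (suc k) ≡ + 0) → sumℤ (suc N) g ≡ g 0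
sumℤ-leading zero g _ = ℤ.+-identityˡ (g 0)
sumℤ-leading (suc N) g g≡0 = begin
  sumℤ (suc N) g ℤ.+ g (suc N)
    ≡⟨ cong₂ ℤ._+_ (sumℤ-leading N g (λ k k<N → g≡0 k (m<n⇒m<1+n k<N))) (g≡0 N ≤-refl) ⟩
  g 0 ℤ.+ + 0
    ≡⟨ ℤ.+-identityʳ (g 0) ⟩
  g 0 ∎

alternating-telescope : ∀ N (Z Y X : ℕ → ℤ) → Z 0 ≡ Y 0 → (∀ k → k < N → Z (suc k) ≡ Y (suc k) ℤ.- X k) →
  sumℤ (suc N) (λ k → sign k ℤ.* (Z k ℤ.- X k)) ≡ sumℤ (suc N) (λ k → sign k ℤ.* Y k) ℤ.- sign N ℤ.* X N
alternating-telescope zero Z Y X Z₀≡Y₀ _ rewrite Z₀≡Y₀ =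
  solve 2 (λ y x → con (+ 0) :+ con (+ 1) :* (y :- x) := (con (+ 0) :+ con (+ 1) :* y) :- con (+ 1) :* x)
    refl (Y 0) (X 0)
alternating-telescope (suc N) Z Y X Z₀≡Y₀ Z≡Y-X
  rewrite alternating-telescope N Z Y X Z₀≡Y₀ (λ k k<N → Z≡Y-X k (m<n⇒m<1+n k<N)) | Z≡Y-X N ≤-refl =
  solve 5 (λ S s x y x′ → (S :- s :* x) :+ (:- s) :* ((y :- x) :- x′) := (S :+ (:- s) :* y) :- (:- s) :* x′)
    refl (sumℤ (suc N) (λ k → sign k ℤ.* Y k)) (sign N) (X N) (Y (suc N)) (X (suc N))

sumFrom1-cong : ∀ N {f g : ℕ → ℤ} → (∀ j → f j ≡ g j) → sumFrom1 N f ≡ sumFrom1 N g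
sumFrom1-cong zero f≡g = refl
sumFrom1-cong (suc N) f≡g = cong₂ ℤ._+_ (sumFrom1-cong N f≡g) (f≡g (suc N))

sumFrom1-+ : ∀ N (f g : ℕ → ℤ) → sumFrom1 N (λ j → f j ℤ.+ g j) ≡ sumFrom1 N f ℤ.+ sumFrom1 N g
sumFrom1-+ zero f g = refl
sumFrom1-+ (suc N) f g rewrite sumFrom1-+ N f g =
  solve 4 (λ a b c d → (a :+ b) :+ (c :+ d) := (a :+ c) :+ (b :+ d)) refl
    (sumFrom1 N f) (sumFrom1 N g) (f (suc N)) (g (suc N))

sumFrom1-truncate : ∀ {K N} (f : ℕ → ℤ) → K ≤ N → (∀ j → K < j → f j ≡ + 0) → sumFrom1 N f ≡ sumFrom1 K f
sumFrom1-truncate {N = zero} f z≤n _ = refl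
sumFrom1-truncate {N = suc N} f K≤1+N f≡0 with m≤n⇒m<n∨m≡n K≤1+N
... | inj₂ refl = refl
... | inj₁ (s≤s K≤N) =
  trans (cong₂ ℤ._+_ (sumFrom1-truncate f K≤N f≡0) (f≡0 (suc N) (s≤s K≤N))) (ℤ.+-identityʳ _)

𝟙 : Bool → ℕ
𝟙 b = if b then 1 else 0

𝟙-∧ : ∀ a b → 𝟙 (a ∧ b) ≡ 𝟙 a * 𝟙 b
𝟙-∧ true b = sym (+-identityʳ (𝟙 b))
𝟙-∧ false b = refl

sumOver : List A → (A → ℕ) → ℕ
sumOver [] f = 0
sumOver (x ∷ xs) f = f x + sumOver xs f

infix 10 sumOver
syntax sumOver xs (λ x → e) = ∑[ x ∈ xs ] e

sumOver-cong : ∀ (xs : List A) {f g : A → ℕ} → (∀ x → f x ≡ g x) → ∑[ x ∈ xs ] f x ≡ ∑[ x ∈ xs ] g x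
sumOver-cong [] f≡g = refl
sumOver-cong (x ∷ xs) f≡g = cong₂ _+_ (f≡g x) (sumOver-cong xs f≡g)

sumOver-zero : ∀ (xs : List A) → ∑[ x ∈ xs ] 0 ≡ 0
sumOver-zero [] = refl
sumOver-zero (x ∷ xs) = sumOver-zero xs

sumOver-++ : ∀ (xs ys : List A) (f : A → ℕ) → ∑[ x ∈ xs ++ ys ] f x ≡ ∑[ x ∈ xs ] f x + ∑[ x ∈ ys ] f x
sumOver-++ [] ys f = refl
sumOver-++ (x ∷ xs) ys f = trans (cong (_+_ (f x)) (sumOver-++ xs ys f)) (sym (+-assoc (f x) _ _))

sumOver-+ : ∀ (xs : List A) (f g : A → ℕ) → ∑[ x ∈ xs ] (f x + g x) ≡ ∑[ x ∈ xs ] f x + ∑[ x ∈ xs ] g x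
sumOver-+ [] f g = refl
sumOver-+ (x ∷ xs) f g = trans (cong (_+_ (f x + g x)) (sumOver-+ xs f g)) (interchange (f x) (g x) _ _)

sumOver-*ˡ : ∀ (xs : List A) a (f : A → ℕ) → ∑[ x ∈ xs ] (a * f x) ≡ a * ∑[ x ∈ xs ] f x
sumOver-*ˡ [] a f = sym (*-zeroʳ a)
sumOver-*ˡ (x ∷ xs) a f = trans (cong (_+_ (a * f x)) (sumOver-*ˡ xs a f)) (sym (*-distribˡ-+ a (f x) _))

sumOver-*ʳ : ∀ (xs : List A) a (f : A → ℕ) → ∑[ x ∈ xs ] (f x * a) ≡ (∑[ x ∈ xs ] f x) * a
sumOver-*ʳ xs a f = trans (sumOver-cong xs (λ x → *-comm (f x) a)) (trans (sumOver-*ˡ xs a f) (*-comm a _))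

sumOver-if : ∀ (xs : List A) (f g : A → ℕ) b →
  ∑[ x ∈ xs ] (f x * (if b then g x else 0)) ≡ (if b then ∑[ x ∈ xs ] (f x * g x) else 0)
sumOver-if xs f g true = refl
sumOver-if xs f g false = trans (sumOver-cong xs (λ x → *-zeroʳ (f x))) (sumOver-zero xs)

sumOver-filterᵇ : ∀ (p : A → Bool) xs (f : A → ℕ) → ∑[ x ∈ filterᵇ p xs ] f x ≡ ∑[ x ∈ xs ] (𝟙 (p x) * f x)
sumOver-filterᵇ p [] f = refl
sumOver-filterᵇ p (x ∷ xs) f with p x
... | true = cong₂ _+_ (sym (+-identityʳ (f x))) (sumOver-filterᵇ p xs f)
... | false = sumOver-filterᵇ p xs f

countB≡sumOver : ∀ (p : A → Bool) xs → countB p xs ≡ ∑[ x ∈ xs ] 𝟙 (p x)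
countB≡sumOver p [] = refl
countB≡sumOver p (x ∷ xs) = cong (_+_ (𝟙 (p x))) (countB≡sumOver p xs)

sumOver-map : ∀ (g : A → B) xs (f : B → ℕ) → ∑[ y ∈ map g xs ] f y ≡ ∑[ x ∈ xs ] f (g x)
sumOver-map g [] f = refl
sumOver-map g (x ∷ xs) f = cong (_+_ (f (g x))) (sumOver-map g xs f)

sumOver-concatMap : ∀ (g : A → List B) xs (f : B → ℕ) →
  ∑[ y ∈ concatMap g xs ] f y ≡ ∑[ x ∈ xs ] ∑[ y ∈ g x ] f y
sumOver-concatMap g [] f = refl
sumOver-concatMap g (x ∷ xs) f =
  trans (sumOver-++ (g x) (concatMap g xs) f) (cong (_+_ _) (sumOver-concatMap g xs f))

sumOver-cartesianProduct : ∀ (xs : List A) (ys : List B) (f : A × B → ℕ) →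
  ∑[ p ∈ cartesianProduct xs ys ] f p ≡ ∑[ x ∈ xs ] ∑[ y ∈ ys ] f (x , y)
sumOver-cartesianProduct [] ys f = refl
sumOver-cartesianProduct (x ∷ xs) ys f = trans (sumOver-++ (map (x ,_) ys) (cartesianProduct xs ys) f)
  (cong₂ _+_ (sumOver-map (x ,_) ys f) (sumOver-cartesianProduct xs ys f))

sumOver-comm : ∀ (xs : List A) (ys : List B) (f : A → B → ℕ) →
  ∑[ x ∈ xs ] ∑[ y ∈ ys ] f x y ≡ ∑[ y ∈ ys ] ∑[ x ∈ xs ] f x y
sumOver-comm [] ys f = sym (sumOver-zero ys)
sumOver-comm (x ∷ xs) ys f =
  trans (cong (_+_ _) (sumOver-comm xs ys f)) (sym (sumOver-+ ys (f x) (λ y → ∑[ x′ ∈ xs ] f x′ y)))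

sumOver-𝟙-∧ : ∀ (xs : List A) (ys : List B) (p : A → Bool) (q : B → Bool) →
  ∑[ x ∈ xs ] ∑[ y ∈ ys ] 𝟙 (p x ∧ q y) ≡ (∑[ x ∈ xs ] 𝟙 (p x)) * (∑[ y ∈ ys ] 𝟙 (q y))
sumOver-𝟙-∧ xs ys p q = begin
  ∑[ x ∈ xs ] ∑[ y ∈ ys ] 𝟙 (p x ∧ q y)
    ≡⟨ sumOver-cong xs (λ x → sumOver-cong ys (λ y → 𝟙-∧ (p x) (q y))) ⟩
  ∑[ x ∈ xs ] ∑[ y ∈ ys ] (𝟙 (p x) * 𝟙 (q y))
    ≡⟨ sumOver-cong xs (λ x → sumOver-*ˡ ys (𝟙 (p x)) (𝟙 ∘ q)) ⟩
  ∑[ x ∈ xs ] (𝟙 (p x) * ∑[ y ∈ ys ] 𝟙 (q y))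
    ≡⟨ sumOver-*ʳ xs _ (𝟙 ∘ p) ⟩
  (∑[ x ∈ xs ] 𝟙 (p x)) * (∑[ y ∈ ys ] 𝟙 (q y)) ∎

sumOver-tabulate : ∀ {n} (g : Fin n → A) (f : A → ℕ) → ∑[ x ∈ tabulate g ] f x ≡ ∑[ i < n ] f (g i)
sumOver-tabulate {n = zero} g f = refl
sumOver-tabulate {n = suc n} g f = cong (_+_ (f (g Fin.zero))) (sumOver-tabulate (g ∘ Fin.suc) f)

sumOver-allFin : ∀ k (f : ℕ → ℕ) → ∑[ i ∈ allFin k ] f (toℕ i) ≡ sumℕ k f
sumOver-allFin zero f = refl
sumOver-allFin (suc k) f = begin
  ∑[ i ∈ allFin (suc k) ] f (toℕ i)        ≡⟨ sumOver-tabulate {n = suc k} id (f ∘ toℕ) ⟩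
  f 0 + ∑[ i < k ] f (suc (toℕ i))         ≡⟨ cong (_+_ (f 0)) (sumOver-tabulate {n = k} id (f ∘ suc ∘ toℕ)) ⟨
  f 0 + ∑[ i ∈ allFin k ] f (suc (toℕ i))  ≡⟨ cong (_+_ (f 0)) (sumOver-allFin k (f ∘ suc)) ⟩
  f 0 + sumℕ k (f ∘ suc)                   ≡⟨ sumℕ-cons k f ⟨
  sumℕ (suc k) f                           ∎

-- Enumerations and the bijection principle

record Enumeration (A : Set) : Set where
  field
    elements : List A
    _≟_ : DecidableEquality A
    occurs-once : ∀ z → ∑[ x ∈ elements ] 𝟙 (does (x ≟ z)) ≡ 1

  sum-select : ∀ z (f : A → ℕ) → ∑[ x ∈ elements ] (𝟙 (does (x ≟ z)) * f x) ≡ f z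
  sum-select z f = begin
    ∑[ x ∈ elements ] (𝟙 (does (x ≟ z)) * f x)   ≡⟨ sumOver-cong elements only-z ⟩
    ∑[ x ∈ elements ] (𝟙 (does (x ≟ z)) * f z)   ≡⟨ sumOver-*ʳ elements (f z) _ ⟩
    (∑[ x ∈ elements ] 𝟙 (does (x ≟ z))) * f z   ≡⟨ cong (_* f z) (occurs-once z) ⟩
    1 * f z                                     ≡⟨ *-identityˡ (f z) ⟩
    f z                                         ∎
    where
    only-z : ∀ x → 𝟙 (does (x ≟ z)) * f x ≡ 𝟙 (does (x ≟ z)) * f z
    only-z x with x ≟ z
    ... | yes refl = refl
    ... | no _ = refl

open Enumeration using (elements; occurs-once)

finᴱ : ∀ n → Enumeration (Fin n)
finᴱ n = record
  { elements = allFin n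
  ; _≟_ = Fin._≟_
  ; occurs-once = λ z → trans (sumOver-tabulate id (λ i → 𝟙 (does (i Fin.≟ z)))) (once z)
  }
  where
  once : ∀ {n} (z : Fin n) → ∑[ i < n ] 𝟙 (does (i Fin.≟ z)) ≡ 1
  once {suc n} Fin.zero = cong suc (sum-replicate-zero n)
  once (Fin.suc z) = once z

vecᴱ : Enumeration A → ∀ n → Enumeration (Vec A n)
vecᴱ {A} E n = record { elements = allVec xs n ; _≟_ = _≟ᵛ_ ; occurs-once = once n }
  where
  open Enumeration E using (_≟_) renaming (elements to xs)
  _≟ᵛ_ : ∀ {n} → DecidableEquality (Vec A n)
  _≟ᵛ_ = Vec.≡-dec _≟_
  once : ∀ n (zs : Vec A n) → ∑[ v ∈ allVec xs n ] 𝟙 (does (v ≟ᵛ zs)) ≡ 1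
  once zero [] = refl
  once (suc n) (z ∷ zs) = begin
    ∑[ v ∈ allVec xs (suc n) ] 𝟙 (does (v ≟ᵛ (z ∷ zs)))
      ≡⟨ sumOver-concatMap (λ x → map (x ∷_) (allVec xs n)) xs _ ⟩
    ∑[ x ∈ xs ] ∑[ v ∈ map (x ∷_) (allVec xs n) ] 𝟙 (does (v ≟ᵛ (z ∷ zs)))
      ≡⟨ sumOver-cong xs (λ x → sumOver-map (x ∷_) (allVec xs n) _) ⟩
    ∑[ x ∈ xs ] ∑[ v ∈ allVec xs n ] 𝟙 (does (x ≟ z) ∧ does (v ≟ᵛ zs))
      ≡⟨ sumOver-𝟙-∧ xs (allVec xs n) _ _ ⟩
    (∑[ x ∈ xs ] 𝟙 (does (x ≟ z))) * (∑[ v ∈ allVec xs n ] 𝟙 (does (v ≟ᵛ zs)))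
      ≡⟨ cong₂ _*_ (occurs-once E z) (once n zs) ⟩
    1 ∎

_×ᴱ_ : Enumeration A → Enumeration B → Enumeration (A × B)
_×ᴱ_ {A} {B} E F = record
  { elements = cartesianProduct (elements E) (elements F)
  ; _≟_ = _≟ᵖ_
  ; occurs-once = λ (a , b) →
      trans (sumOver-cartesianProduct (elements E) (elements F) _)
            (trans (sumOver-𝟙-∧ (elements E) (elements F) _ _) (cong₂ _*_ (occurs-once E a) (occurs-once F b)))
  }
  where
  _≟ᵖ_ : DecidableEquality (A × B)
  (a , b) ≟ᵖ (a′ , b′) =
    map′ (uncurry (cong₂ _,_)) ,-injective (Enumeration._≟_ E a a′ ×-dec Enumeration._≟_ F b b′)

module _ (E : Enumeration A) (F : Enumeration B)
         (P : A → Bool) (Q : B → Bool) (g : B → A) (h : A → B)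
         (g-sound : ∀ y → Q y ≡ true → P (g y) ≡ true)
         (h-sound : ∀ x → P x ≡ true → Q (h x) ≡ true)
         (h∘g : ∀ y → Q y ≡ true → h (g y) ≡ y)
         (g∘h : ∀ x → P x ≡ true → g (h x) ≡ x)
  where
  private
    module E = Enumeration E
    module F = Enumeration F

  fibre-size : ∀ x → ∑[ y ∈ F.elements ] (𝟙 (Q y) * 𝟙 (does (x E.≟ g y))) ≡ 𝟙 (P x)
  fibre-size x with P x in Px
  ... | true = trans (sumOver-cong F.elements fibre-is-h) (F.occurs-once (h x))
    where
    fibre-is-h : ∀ y → 𝟙 (Q y) * 𝟙 (does (x E.≟ g y)) ≡ 𝟙 (does (y F.≟ h x))
    fibre-is-h y with Q y in Qy
    ... | true = trans (+-identityʳ _) (cong 𝟙 (does-⇔ (mk⇔ x≡gy⇒y≡hx y≡hx⇒x≡gy) (x E.≟ g y) (y F.≟ h x)))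
      where
      x≡gy⇒y≡hx : x ≡ g y → y ≡ h x
      x≡gy⇒y≡hx x≡gy = trans (sym (h∘g y Qy)) (cong h (sym x≡gy))
      y≡hx⇒x≡gy : y ≡ h x → x ≡ g y
      y≡hx⇒x≡gy y≡hx = trans (sym (g∘h x Px)) (cong g (sym y≡hx))
    ... | false = cong 𝟙 (sym (dec-false (y F.≟ h x) y≢hx))
      where
      y≢hx : y ≢ h x
      y≢hx y≡hx = contradiction (trans (sym Qy) (trans (cong Q y≡hx) (h-sound x Px))) λ ()
  ... | false = trans (sumOver-cong F.elements empty-fibre) (sumOver-zero F.elements)
    where
    empty-fibre : ∀ y → 𝟙 (Q y) * 𝟙 (does (x E.≟ g y)) ≡ 0
    empty-fibre y with Q y in Qy | x E.≟ g y
    ... | false | _ = refl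
    ... | true | no _ = refl
    ... | true | yes refl = contradiction (trans (sym Px) (g-sound y Qy)) λ ()

  sum-bijection : ∀ f → ∑[ x ∈ E.elements ] (𝟙 (P x) * f x) ≡ ∑[ y ∈ F.elements ] (𝟙 (Q y) * f (g y))
  sum-bijection f = begin
    ∑[ x ∈ E.elements ] (𝟙 (P x) * f x)
      ≡⟨ sumOver-cong E.elements (λ x → cong (_* f x) (sym (fibre-size x))) ⟩
    ∑[ x ∈ E.elements ] ((∑[ y ∈ F.elements ] (𝟙 (Q y) * 𝟙 (does (x E.≟ g y)))) * f x)
      ≡⟨ sumOver-cong E.elements (λ x → sym (sumOver-*ʳ F.elements (f x) _)) ⟩
    ∑[ x ∈ E.elements ] ∑[ y ∈ F.elements ] (𝟙 (Q y) * 𝟙 (does (x E.≟ g y)) * f x)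
      ≡⟨ sumOver-comm E.elements F.elements _ ⟩
    ∑[ y ∈ F.elements ] ∑[ x ∈ E.elements ] (𝟙 (Q y) * 𝟙 (does (x E.≟ g y)) * f x)
      ≡⟨ sumOver-cong F.elements (λ y → trans (sumOver-cong E.elements (λ x → *-assoc (𝟙 (Q y)) _ (f x)))
                                              (sumOver-*ˡ E.elements (𝟙 (Q y)) _)) ⟩
    ∑[ y ∈ F.elements ] (𝟙 (Q y) * ∑[ x ∈ E.elements ] (𝟙 (does (x E.≟ g y)) * f x))
      ≡⟨ sumOver-cong F.elements (λ y → cong (𝟙 (Q y) *_) (E.sum-select (g y) f)) ⟩
    ∑[ y ∈ F.elements ] (𝟙 (Q y) * f (g y)) ∎

-- Coloured permutations

filterᵇ-unique : ∀ (p : A → Bool) (F : List A → List A) → F [] ≡ [] →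
  (∀ x xs → F (x ∷ xs) ≡ (if p x then x ∷ F xs else F xs)) → ∀ xs → F xs ≡ filterᵇ p xs
filterᵇ-unique p F F[] F∷ [] = F[]
filterᵇ-unique p F F[] F∷ (x ∷ xs) rewrite F∷ x xs with p x
... | true = cong (x ∷_) (filterᵇ-unique p F F[] F∷ xs)
... | false = filterᵇ-unique p F F[] F∷ xs

-- `permutations` and `pairs` filter with unnamed functions local to Defs; unification solves each meta below
-- to one of them.
mutual
  permutationsFilter : (n : ℕ) → List (Vec (Fin n) n) → List (Vec (Fin n) n)
  permutationsFilter = _

  permutations≡filterᵇ : ∀ n → permutations n ≡ filterᵇ isPerm (allVec (allFin n) n)
  permutations≡filterᵇ n with allVec (allFin n) n
  ... | vs = filterᵇ-unique isPerm (permutationsFilter n) refl (λ _ _ → refl) vs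

mutual
  pairsFilter : (n : ℕ) → List (Fin n × Fin n) → List (Fin n × Fin n)
  pairsFilter = _

  pairs≡filterᵇ : ∀ n → pairs n ≡ filterᵇ (uncurry _<F_) (cartesianProduct (allFin n) (allFin n))
  pairs≡filterᵇ n with cartesianProduct (allFin n) (allFin n)
  ... | ps = filterᵇ-unique (uncurry _<F_) (pairsFilter n) refl (λ _ _ → refl) ps

≤ᵇ∧≥ᵇ : ∀ a b → (a ≤ᵇ b) ∧ (b ≤ᵇ a) ≡ does (a ℕ.≟ b)
≤ᵇ∧≥ᵇ a b =
  does-⇔ (mk⇔ (uncurry ≤-antisym) (λ { refl → ≤-refl , ≤-refl })) ((a ℕ.≤? b) ×-dec (b ℕ.≤? a)) (a ℕ.≟ b)

colouredWordsᴱ : ∀ c n → Enumeration (ColPerm c n)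
colouredWordsᴱ c n = vecᴱ (finᴱ n) n ×ᴱ vecᴱ (finᴱ c) n

ic≡sum : ∀ c n k →
  ic c n k ≡ ∑[ σ ∈ elements (colouredWordsᴱ c n) ] (𝟙 (isPerm (proj₁ σ)) * 𝟙 (does (invc σ ℕ.≟ k)))
ic≡sum c n k = begin
  ic c n k
    ≡⟨ countB≡sumOver _ (cartesianProduct (permutations n) colourings) ⟩
  ∑[ σ ∈ cartesianProduct (permutations n) colourings ] 𝟙 ((invc σ ≤ᵇ k) ∧ (k ≤ᵇ invc σ))
    ≡⟨ sumOver-cong (cartesianProduct (permutations n) colourings) (λ σ → cong 𝟙 (≤ᵇ∧≥ᵇ (invc σ) k)) ⟩
  ∑[ σ ∈ cartesianProduct (permutations n) colourings ] 𝟙 (does (invc σ ℕ.≟ k))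
    ≡⟨ cong (λ ps → ∑[ σ ∈ cartesianProduct ps colourings ] 𝟙 (does (invc σ ℕ.≟ k))) (permutations≡filterᵇ n) ⟩
  ∑[ σ ∈ cartesianProduct (filterᵇ isPerm words) colourings ] 𝟙 (does (invc σ ℕ.≟ k))
    ≡⟨ sumOver-cartesianProduct (filterᵇ isPerm words) colourings _ ⟩
  ∑[ π ∈ filterᵇ isPerm words ] ∑[ cs ∈ colourings ] 𝟙 (does (invc (π , cs) ℕ.≟ k))
    ≡⟨ sumOver-filterᵇ isPerm words _ ⟩
  ∑[ π ∈ words ] (𝟙 (isPerm π) * ∑[ cs ∈ colourings ] 𝟙 (does (invc (π , cs) ℕ.≟ k)))
    ≡⟨ sumOver-cong words (λ π → sumOver-*ˡ colourings (𝟙 (isPerm π)) _) ⟨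
  ∑[ π ∈ words ] ∑[ cs ∈ colourings ] (𝟙 (isPerm π) * 𝟙 (does (invc (π , cs) ℕ.≟ k)))
    ≡⟨ sumOver-cartesianProduct words colourings _ ⟨
  ∑[ σ ∈ cartesianProduct words colourings ] (𝟙 (isPerm (proj₁ σ)) * 𝟙 (does (invc σ ℕ.≟ k))) ∎
  where
  words = allVec (allFin n) n
  colourings = allVec (allFin c) n

ic-zero : ∀ c k → ic c 0 k ≡ 𝟙 (does (0 ℕ.≟ k))
ic-zero c k = begin
  ic c 0 k                                   ≡⟨ ic≡sum c 0 k ⟩
  1 * 𝟙 (does (c * 0 ℕ.≟ k)) + 0             ≡⟨ trans (+-identityʳ _) (*-identityˡ _) ⟩
  𝟙 (does (c * 0 ℕ.≟ k))                     ≡⟨ cong (λ e → 𝟙 (does (e ℕ.≟ k))) (*-zeroʳ c) ⟩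
  𝟙 (does (0 ℕ.≟ k))                         ∎

colouredAscents : ∀ {c n} → ColPerm c n → ℕ
colouredAscents {n = n} (π , cs) =
  countB (λ { (i , j) → (lookup π i <F lookup π j) ∧ (0 <ᵇ toℕ (lookup cs j)) }) (pairs n)

pairSum : ∀ n → (Fin n → Fin n → ℕ) → ℕ
pairSum n φ = ∑[ i < n ] ∑[ j < n ] (𝟙 (i <F j) * φ i j)

pairSum-cong : ∀ n {φ ψ : Fin n → Fin n → ℕ} → (∀ i j → φ i j ≡ ψ i j) → pairSum n φ ≡ pairSum n ψ
pairSum-cong n φ≡ψ = sum-cong-≗ {n} (λ i → sum-cong-≗ {n} (λ j → cong (𝟙 (i <F j) *_) (φ≡ψ i j)))

countB-pairs : ∀ n (p : Fin n × Fin n → Bool) → countB p (pairs n) ≡ pairSum n (λ i j → 𝟙 (p (i , j)))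
countB-pairs n p = begin
  countB p (pairs n)
    ≡⟨ countB≡sumOver p (pairs n) ⟩
  ∑[ ij ∈ pairs n ] 𝟙 (p ij)
    ≡⟨ cong (λ ps → ∑[ ij ∈ ps ] 𝟙 (p ij)) (pairs≡filterᵇ n) ⟩
  ∑[ ij ∈ filterᵇ (uncurry _<F_) (cartesianProduct is is) ] 𝟙 (p ij)
    ≡⟨ sumOver-filterᵇ (uncurry _<F_) (cartesianProduct is is) (𝟙 ∘ p) ⟩
  ∑[ ij ∈ cartesianProduct is is ] (𝟙 (uncurry _<F_ ij) * 𝟙 (p ij))
    ≡⟨ sumOver-cartesianProduct is is _ ⟩
  ∑[ i ∈ is ] ∑[ j ∈ is ] (𝟙 (i <F j) * 𝟙 (p (i , j)))
    ≡⟨ sumOver-tabulate id (λ i → ∑[ j ∈ is ] (𝟙 (i <F j) * 𝟙 (p (i , j)))) ⟩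
  ∑[ i < n ] ∑[ j ∈ is ] (𝟙 (i <F j) * 𝟙 (p (i , j)))
    ≡⟨ sum-cong-≗ (λ i → sumOver-tabulate id (λ j → 𝟙 (i <F j) * 𝟙 (p (i , j)))) ⟩
  pairSum n (λ i j → 𝟙 (p (i , j))) ∎
  where
  is = allFin n

≤ᵇ≡<ᵇsuc : ∀ a b → (a ≤ᵇ b) ≡ (a <ᵇ suc b)
≤ᵇ≡<ᵇsuc zero b = refl
≤ᵇ≡<ᵇsuc (suc a) b = refl

<F-irrefl : ∀ {n} (p : Fin n) → (p <F p) ≡ false
<F-irrefl p = <ᵇ-irrefl (toℕ p)
  where
  <ᵇ-irrefl : ∀ a → (a <ᵇ a) ≡ false
  <ᵇ-irrefl zero = refl
  <ᵇ-irrefl (suc a) = <ᵇ-irrefl a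

punchIn-<F : ∀ {n} (p : Fin (suc n)) i j → (punchIn p i <F punchIn p j) ≡ (i <F j)
punchIn-<F Fin.zero i j = refl
punchIn-<F (Fin.suc p) Fin.zero Fin.zero = refl
punchIn-<F (Fin.suc p) Fin.zero (Fin.suc j) = refl
punchIn-<F (Fin.suc p) (Fin.suc i) Fin.zero = refl
punchIn-<F (Fin.suc p) (Fin.suc i) (Fin.suc j) = punchIn-<F p i j

<F-punchInʳ : ∀ {n} (p : Fin (suc n)) j → (p <F punchIn p j) ≡ (toℕ p ≤ᵇ toℕ j)
<F-punchInʳ Fin.zero j = refl
<F-punchInʳ (Fin.suc p) Fin.zero = refl
<F-punchInʳ (Fin.suc p) (Fin.suc j) = trans (<F-punchInʳ p j) (≤ᵇ≡<ᵇsuc (toℕ p) (toℕ j))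

<F-punchInˡ : ∀ {n} (p : Fin (suc n)) i → (punchIn p i <F p) ≡ (toℕ i <ᵇ toℕ p)
<F-punchInˡ Fin.zero i = refl
<F-punchInˡ (Fin.suc p) Fin.zero = refl
<F-punchInˡ (Fin.suc p) (Fin.suc i) = <F-punchInˡ p i

pairSum-punchIn : ∀ {n} (p : Fin (suc n)) (φ : Fin (suc n) → Fin (suc n) → ℕ) →
  pairSum (suc n) φ ≡ ∑[ j < n ] (𝟙 (toℕ p ≤ᵇ toℕ j) * φ p (punchIn p j))
                    + (∑[ i < n ] (𝟙 (toℕ i <ᵇ toℕ p) * φ (punchIn p i) p)
                    + pairSum n (λ i j → φ (punchIn p i) (punchIn p j)))
pairSum-punchIn {n} p φ = begin
  pairSum (suc n) φ
    ≡⟨ sum-remove {i = p} row ⟩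
  row p + ∑[ i < n ] row (punchIn p i)
    ≡⟨ cong₂ _+_ (sum-remove {i = p} (λ j → 𝟙 (p <F j) * φ p j))
                 (sum-cong-≗ (λ i → sum-remove {i = p} (λ j → 𝟙 (punchIn p i <F j) * φ (punchIn p i) j))) ⟩
  (𝟙 (p <F p) * φ p p + ∑[ j < n ] (𝟙 (p <F punchIn p j) * φ p (punchIn p j)))
    + ∑[ i < n ] (𝟙 (punchIn p i <F p) * φ (punchIn p i) p + ∑[ j < n ] ψ (punchIn p i) (punchIn p j))
    ≡⟨ cong₂ _+_ (cong₂ (λ b s → 𝟙 b * φ p p + s) (<F-irrefl p)
                        (sum-cong-≗ (λ j → cong (λ b → 𝟙 b * φ p (punchIn p j)) (<F-punchInʳ p j))))
                 (∑-distrib-+ (λ i → 𝟙 (punchIn p i <F p) * φ (punchIn p i) p)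
                              (λ i → ∑[ j < n ] ψ (punchIn p i) (punchIn p j))) ⟩
  ∑[ j < n ] (𝟙 (toℕ p ≤ᵇ toℕ j) * φ p (punchIn p j))
    + (∑[ i < n ] (𝟙 (punchIn p i <F p) * φ (punchIn p i) p)
      + ∑[ i < n ] ∑[ j < n ] ψ (punchIn p i) (punchIn p j))
    ≡⟨ cong (_+_ (∑[ j < n ] (𝟙 (toℕ p ≤ᵇ toℕ j) * φ p (punchIn p j)))) (cong₂ _+_
         (sum-cong-≗ {n} (λ i → cong (λ b → 𝟙 b * φ (punchIn p i) p) (<F-punchInˡ p i)))
         (sum-cong-≗ {n} (λ i → sum-cong-≗ {n} (λ j →
           cong (λ b → 𝟙 b * φ (punchIn p i) (punchIn p j)) (punchIn-<F p i j))))) ⟩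
  ∑[ j < n ] (𝟙 (toℕ p ≤ᵇ toℕ j) * φ p (punchIn p j))
    + (∑[ i < n ] (𝟙 (toℕ i <ᵇ toℕ p) * φ (punchIn p i) p)
    + pairSum n (λ i j → φ (punchIn p i) (punchIn p j))) ∎
  where
  ψ : Fin (suc n) → Fin (suc n) → ℕ
  ψ i j = 𝟙 (i <F j) * φ i j
  row : Fin (suc n) → ℕ
  row i = ∑[ j < suc n ] ψ i j

count-≥ : ∀ n t → ∑[ j < n ] 𝟙 (t ≤ᵇ toℕ j) ≡ n ∸ t
count-≥ zero t = sym (0∸n≡0 t)
count-≥ (suc n) zero = cong suc (count-≥ n 0)
count-≥ (suc n) (suc t) = trans (sum-cong-≗ {n} (λ j → cong 𝟙 (sym (≤ᵇ≡<ᵇsuc t (toℕ j))))) (count-≥ n t)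

count-< : ∀ n t → t ≤ n → ∑[ i < n ] 𝟙 (toℕ i <ᵇ t) ≡ t
count-< n zero _ = sum-replicate-zero n
count-< (suc n) (suc t) (s≤s t≤n) = cong suc (count-< n t t≤n)

allB-sound : ∀ (p : A → Bool) xs → allB p xs ≡ true → ∀ {x} → x ∈ xs → p x ≡ true
allB-sound p (y ∷ ys) all-p (here refl) with p y
... | true = refl
allB-sound p (y ∷ ys) all-p (there x∈ys) with p y
... | true = allB-sound p ys all-p x∈ys

allB-complete : ∀ (p : A → Bool) xs → (∀ {x} → x ∈ xs → p x ≡ true) → allB p xs ≡ true
allB-complete p [] _ = refl
allB-complete p (y ∷ ys) p-holds rewrite p-holds (here refl) = allB-complete p ys (p-holds ∘ there)

∈-pairs⁺ : ∀ {n} {i j : Fin n} → toℕ i < toℕ j → (i , j) ∈ pairs n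
∈-pairs⁺ {n} {i} {j} i<j rewrite pairs≡filterᵇ n =
  ∈-filter⁺ (T? ∘ uncurry _<F_) (∈-cartesianProduct⁺ (∈-allFin i) (∈-allFin j)) (<⇒<ᵇ i<j)

∈-pairs⁻ : ∀ {n} {i j : Fin n} → (i , j) ∈ pairs n → toℕ i < toℕ j
∈-pairs⁻ {n} {i} {j} ij∈pairs rewrite pairs≡filterᵇ n =
  <ᵇ⇒< (toℕ i) (toℕ j) (proj₂ (∈-filter⁻ (T? ∘ uncurry _<F_) {xs = cartesianProduct (allFin n) (allFin n)}
                                           ij∈pairs))

distinctᵇ-sound : ∀ a b → not ((a ≤ᵇ b) ∧ (b ≤ᵇ a)) ≡ true → a ≢ b
distinctᵇ-sound a b distinct a≡b =
  contradiction (trans (sym distinct) (cong not (trans (≤ᵇ∧≥ᵇ a b) (dec-true (a ℕ.≟ b) a≡b)))) λ ()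

distinctᵇ-complete : ∀ a b → a ≢ b → not ((a ≤ᵇ b) ∧ (b ≤ᵇ a)) ≡ true
distinctᵇ-complete a b a≢b rewrite ≤ᵇ∧≥ᵇ a b | dec-false (a ℕ.≟ b) a≢b = refl

isPerm⇒distinct : ∀ {n} (π : Vec (Fin n) n) → isPerm π ≡ true →
  ∀ {i j} → toℕ i < toℕ j → lookup π i ≢ lookup π j
isPerm⇒distinct {n} π perm {i} {j} i<j πi≡πj =
  distinctᵇ-sound _ _ (allB-sound _ (pairs n) perm (∈-pairs⁺ i<j)) (cong toℕ πi≡πj)

isPerm⇒injective : ∀ {n} (π : Vec (Fin n) n) → isPerm π ≡ true → Injective _≡_ _≡_ (lookup π)
isPerm⇒injective π perm {i} {j} πi≡πj with <-cmp (toℕ i) (toℕ j)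
... | tri≈ _ i≡j _ = Fin.toℕ-injective i≡j
... | tri< i<j _ _ = contradiction πi≡πj (isPerm⇒distinct π perm i<j)
... | tri> _ _ j<i = contradiction (sym πi≡πj) (isPerm⇒distinct π perm j<i)

injective⇒isPerm : ∀ {n} (π : Vec (Fin n) n) → Injective _≡_ _≡_ (lookup π) → isPerm π ≡ true
injective⇒isPerm {n} π inj = allB-complete _ (pairs n) λ ij∈pairs →
  distinctᵇ-complete _ _ (λ eq → <-irrefl (cong toℕ (inj (Fin.toℕ-injective eq))) (∈-pairs⁻ ij∈pairs))

insertMax : ∀ {n} → Fin (suc n) → Vec (Fin n) n → Vec (Fin (suc n)) (suc n)
insertMax {n} p π = insertAt (Vec.map inject₁ π) p (fromℕ n)

inject₁<F-fromℕ : ∀ {n} (a : Fin n) → (inject₁ a <F fromℕ n) ≡ true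
inject₁<F-fromℕ {n} a rewrite Fin.toℕ-inject₁ a | Fin.toℕ-fromℕ n = dec-true (toℕ a ℕ.<? n) (Fin.toℕ<n a)

fromℕ<F-inject₁ : ∀ {n} (a : Fin n) → (fromℕ n <F inject₁ a) ≡ false
fromℕ<F-inject₁ {n} a rewrite Fin.toℕ-inject₁ a | Fin.toℕ-fromℕ n = dec-false (n ℕ.<? toℕ a) (<⇒≯ (Fin.toℕ<n a))

inject₁<F-inject₁ : ∀ {n} (a b : Fin n) → (inject₁ a <F inject₁ b) ≡ (a <F b)
inject₁<F-inject₁ a b rewrite Fin.toℕ-inject₁ a | Fin.toℕ-inject₁ b = refl

module _ {n} (p : Fin (suc n)) (π : Vec (Fin n) n) where
  private
    π′ = insertMax p π

  lookup-insertMax-p : lookup π′ p ≡ fromℕ n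
  lookup-insertMax-p = Vec.insertAt-lookup (Vec.map inject₁ π) p (fromℕ n)

  lookup-insertMax-punchIn : ∀ j → lookup π′ (punchIn p j) ≡ inject₁ (lookup π j)
  lookup-insertMax-punchIn j =
    trans (Vec.insertAt-punchIn (Vec.map inject₁ π) p (fromℕ n) j) (Vec.lookup-map j inject₁ π)

  insertMax-punchIn-<F-p : ∀ j → (lookup π′ (punchIn p j) <F lookup π′ p) ≡ true
  insertMax-punchIn-<F-p j rewrite lookup-insertMax-punchIn j | lookup-insertMax-p =
    inject₁<F-fromℕ (lookup π j)

  insertMax-p-<F-punchIn : ∀ j → (lookup π′ p <F lookup π′ (punchIn p j)) ≡ false
  insertMax-p-<F-punchIn j rewrite lookup-insertMax-punchIn j | lookup-insertMax-p =
    fromℕ<F-inject₁ (lookup π j)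

  insertMax-punchIn-<F : ∀ i j →
    (lookup π′ (punchIn p i) <F lookup π′ (punchIn p j)) ≡ (lookup π i <F lookup π j)
  insertMax-punchIn-<F i j rewrite lookup-insertMax-punchIn i | lookup-insertMax-punchIn j =
    inject₁<F-inject₁ (lookup π i) (lookup π j)

  inv-insertMax : inv π′ ≡ (n ∸ toℕ p) + inv π
  inv-insertMax = begin
    inv π′                      ≡⟨ countB-pairs (suc n) (λ ij → lookup π′ (proj₂ ij) <F lookup π′ (proj₁ ij)) ⟩
    pairSum (suc n) φ           ≡⟨ pairSum-punchIn p φ ⟩
    _                           ≡⟨ cong₂ _+_ from-p (cong₂ _+_ into-p elsewhere) ⟩
    (n ∸ toℕ p) + (0 + inv π)   ∎
    where
    φ : Fin (suc n) → Fin (suc n) → ℕ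
    φ i j = 𝟙 (lookup π′ j <F lookup π′ i)
    from-p : ∑[ j < n ] (𝟙 (toℕ p ≤ᵇ toℕ j) * φ p (punchIn p j)) ≡ n ∸ toℕ p
    from-p = trans (sum-cong-≗ {n} (λ j →
                     trans (cong (λ b → 𝟙 (toℕ p ≤ᵇ toℕ j) * 𝟙 b) (insertMax-punchIn-<F-p j)) (*-identityʳ _)))
                   (count-≥ n (toℕ p))
    into-p : ∑[ i < n ] (𝟙 (toℕ i <ᵇ toℕ p) * φ (punchIn p i) p) ≡ 0
    into-p = trans (sum-cong-≗ {n} (λ i →
                     trans (cong (λ b → 𝟙 (toℕ i <ᵇ toℕ p) * 𝟙 b) (insertMax-p-<F-punchIn i))
                           (*-zeroʳ (𝟙 (toℕ i <ᵇ toℕ p)))))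
                   (sum-replicate-zero n)
    elsewhere : pairSum n (λ i j → φ (punchIn p i) (punchIn p j)) ≡ inv π
    elsewhere = trans (pairSum-cong n (λ i j → cong 𝟙 (insertMax-punchIn-<F j i))) (sym (countB-pairs n _))

  colouredAscents-insertMax : ∀ {c} (cs : Vec (Fin c) n) m →
    colouredAscents (π′ , insertAt cs p m) ≡ toℕ p * 𝟙 (0 <ᵇ toℕ m) + colouredAscents (π , cs)
  colouredAscents-insertMax cs m = begin
    colouredAscents (π′ , cs′)   ≡⟨ countB-pairs (suc n) (λ ij → ascent (proj₁ ij) (proj₂ ij)) ⟩
    pairSum (suc n) φ           ≡⟨ pairSum-punchIn p φ ⟩
    _                           ≡⟨ cong₂ _+_ from-p (cong₂ _+_ into-p elsewhere) ⟩
    0 + (toℕ p * 𝟙 (0 <ᵇ toℕ m) + colouredAscents (π , cs)) ∎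
    where
    cs′ = insertAt cs p m
    ascent : Fin (suc n) → Fin (suc n) → Bool
    ascent i j = (lookup π′ i <F lookup π′ j) ∧ (0 <ᵇ toℕ (lookup cs′ j))
    φ : Fin (suc n) → Fin (suc n) → ℕ
    φ i j = 𝟙 (ascent i j)
    from-p : ∑[ j < n ] (𝟙 (toℕ p ≤ᵇ toℕ j) * φ p (punchIn p j)) ≡ 0
    from-p = trans (sum-cong-≗ {n} (λ j →
                     trans (cong (λ b → 𝟙 (toℕ p ≤ᵇ toℕ j) * 𝟙 (b ∧ (0 <ᵇ toℕ (lookup cs′ (punchIn p j)))))
                                 (insertMax-p-<F-punchIn j))
                           (*-zeroʳ (𝟙 (toℕ p ≤ᵇ toℕ j)))))
                   (sum-replicate-zero n)
    into-p : ∑[ i < n ] (𝟙 (toℕ i <ᵇ toℕ p) * φ (punchIn p i) p) ≡ toℕ p * 𝟙 (0 <ᵇ toℕ m)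
    into-p = begin
      ∑[ i < n ] (𝟙 (toℕ i <ᵇ toℕ p) * φ (punchIn p i) p)
        ≡⟨ sum-cong-≗ {n} (λ i → cong₂ (λ b a → 𝟙 (toℕ i <ᵇ toℕ p) * 𝟙 (b ∧ (0 <ᵇ toℕ a)))
                                        (insertMax-punchIn-<F-p i) (Vec.insertAt-lookup cs p m)) ⟩
      ∑[ i < n ] (𝟙 (toℕ i <ᵇ toℕ p) * 𝟙 (0 <ᵇ toℕ m))
        ≡⟨ *-distribʳ-sum {n} (𝟙 (0 <ᵇ toℕ m)) (λ i → 𝟙 (toℕ i <ᵇ toℕ p)) ⟨
      (∑[ i < n ] 𝟙 (toℕ i <ᵇ toℕ p)) * 𝟙 (0 <ᵇ toℕ m)
        ≡⟨ cong (_* 𝟙 (0 <ᵇ toℕ m)) (count-< n (toℕ p) (ℕ.s≤s⁻¹ (Fin.toℕ<n p))) ⟩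
      toℕ p * 𝟙 (0 <ᵇ toℕ m) ∎
    elsewhere : pairSum n (λ i j → φ (punchIn p i) (punchIn p j)) ≡ colouredAscents (π , cs)
    elsewhere = trans (pairSum-cong n (λ i j →
                        cong₂ (λ b a → 𝟙 (b ∧ (0 <ᵇ toℕ a)))
                              (insertMax-punchIn-<F i j) (Vec.insertAt-punchIn cs p m j)))
                      (sym (countB-pairs n _))

-- The largest letter, inserted at position p with colour m, precedes n − p smaller letters, adds m to col,
-- and, if m ≠ 0, follows p smaller letters, each such pair counting c times.
weight : ℕ → ℕ → ℕ → ℕ → ℕ
weight n c p m = (n ∸ p) + m + c * (p * 𝟙 (0 <ᵇ m))

Insertion : ℕ → ℕ → Set
Insertion c n = (Fin (suc n) × Fin c) × ColPerm c n

insert : ∀ {c n} → Insertion c n → ColPerm c (suc n)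
insert ((p , m) , (π , cs)) = insertMax p π , insertAt cs p m

invc-insert : ∀ {c n} (y : Insertion c n) →
  invc (insert y) ≡ invc (proj₂ y) + weight n c (toℕ (proj₁ (proj₁ y))) (toℕ (proj₂ (proj₁ y)))
invc-insert {c} {n} ((p , m) , (π , cs)) = begin
  inv (insertMax p π) + col (insertAt cs p m) + c * colouredAscents (insertMax p π , insertAt cs p m)
    ≡⟨ cong₂ _+_ (cong₂ _+_ (inv-insertMax p π) (col-insertAt cs p m))
                 (cong (c *_) (colouredAscents-insertMax p π cs m)) ⟩
  (n ∸ toℕ p) + inv π + (toℕ m + col cs) + c * (toℕ p * 𝟙 (0 <ᵇ toℕ m) + colouredAscents (π , cs))
    ≡⟨ solveℕ 7 (λ c d I M C P A → d ⊕ I ⊕ (M ⊕ C) ⊕ c ⊛ (P ⊕ A) ⊜ I ⊕ C ⊕ c ⊛ A ⊕ (d ⊕ M ⊕ c ⊛ P)) refl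
         c (n ∸ toℕ p) (inv π) (toℕ m) (col cs) (toℕ p * 𝟙 (0 <ᵇ toℕ m)) (colouredAscents (π , cs)) ⟩
  invc (π , cs) + weight n c (toℕ p) (toℕ m) ∎
  where
  col-insertAt : ∀ {k} (cs : Vec (Fin c) k) p m → col (insertAt cs p m) ≡ toℕ m + col cs
  col-insertAt cs Fin.zero m = refl
  col-insertAt (x ∷ cs) (Fin.suc p) m rewrite col-insertAt cs p m = x∙yz≈y∙xz (toℕ x) (toℕ m) (col cs)

data PunchInView {n} (p : Fin (suc n)) : Fin (suc n) → Set where
  at-p : PunchInView p p
  punched : ∀ j → PunchInView p (punchIn p j)

punchInView : ∀ {n} (p i : Fin (suc n)) → PunchInView p i
punchInView p i with p Fin.≟ i
... | yes refl = at-p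
... | no p≢i = subst (PunchInView p) (Fin.punchIn-punchOut p≢i) (punched (punchOut p≢i))

module _ {n} (p : Fin (suc n)) (π : Vec (Fin n) n) where

  insertMax-max-unique : ∀ i → lookup (insertMax p π) i ≡ fromℕ n → i ≡ p
  insertMax-max-unique i πi≡max with punchInView p i
  ... | at-p = refl
  ... | punched j = contradiction (trans (sym πi≡max) (lookup-insertMax-punchIn p π j)) Fin.fromℕ≢inject₁

  insertMax-injective : Injective _≡_ _≡_ (lookup π) → Injective _≡_ _≡_ (lookup (insertMax p π))
  insertMax-injective inj {i} {i′} eq with punchInView p i | punchInView p i′
  ... | at-p | at-p = refl
  ... | at-p | punched j =
    contradiction (trans (sym (lookup-insertMax-p p π)) (trans eq (lookup-insertMax-punchIn p π j)))
                  Fin.fromℕ≢inject₁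
  ... | punched j | at-p =
    contradiction (trans (sym (lookup-insertMax-p p π)) (trans (sym eq) (lookup-insertMax-punchIn p π j)))
                  Fin.fromℕ≢inject₁
  ... | punched j | punched j′ = cong (punchIn p) (inj (Fin.inject₁-injective
        (trans (sym (lookup-insertMax-punchIn p π j)) (trans eq (lookup-insertMax-punchIn p π j′)))))

maxPosition : ∀ {n} → Vec (Fin (suc n)) (suc n) → Fin (suc n)
maxPosition {n} π with Fin.any? (λ i → lookup π i Fin.≟ fromℕ n)
... | yes (i , _) = i
... | no _ = Fin.zero

maxPosition-sound : ∀ {n} (π : Vec (Fin (suc n)) (suc n)) i →
  lookup π i ≡ fromℕ n → lookup π (maxPosition π) ≡ fromℕ n
maxPosition-sound {n} π i πi≡max with Fin.any? (λ i → lookup π i Fin.≟ fromℕ n)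
... | yes (_ , found) = found
... | no absent = contradiction (i , πi≡max) absent

-- If the largest letter were missing, π would inject Fin (n + 1) into Fin n.
lookup-maxPosition : ∀ {n} (π : Vec (Fin (suc n)) (suc n)) →
  Injective _≡_ _≡_ (lookup π) → lookup π (maxPosition π) ≡ fromℕ n
lookup-maxPosition {n} π inj with Fin.any? (λ i → lookup π i Fin.≟ fromℕ n)
... | yes (_ , found) = found
... | no absent =
  contradiction (λ {_} {_} eq → inj (Fin.lower₁-injective eq)) (Fin.<⇒notInjective {f = lowered} (n<1+n n))
  where
  lowered : Fin (suc n) → Fin n
  lowered i = Fin.lower₁ (lookup π i) (λ n≡πi →
    absent (i , Fin.toℕ-injective (trans (sym n≡πi) (sym (Fin.toℕ-fromℕ n)))))

maxPosition-insertMax : ∀ {n} (p : Fin (suc n)) (π : Vec (Fin n) n) → maxPosition (insertMax p π) ≡ p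
maxPosition-insertMax p π =
  insertMax-max-unique p π _ (maxPosition-sound (insertMax p π) p (lookup-insertMax-p p π))

lowerAll : ∀ {n} → Vec (Fin (suc n)) n → Vec (Fin n) n
lowerAll {zero} [] = []
lowerAll {suc n} v = Vec.map (pinch (fromℕ n)) v

pinch-inject₁ : ∀ {m} (a : Fin (suc m)) → pinch (fromℕ m) (inject₁ a) ≡ a
pinch-inject₁ {zero} Fin.zero = refl
pinch-inject₁ {suc m} Fin.zero = refl
pinch-inject₁ {suc m} (Fin.suc a) = cong Fin.suc (pinch-inject₁ a)

inject₁-pinch : ∀ {m} (a : Fin (suc (suc m))) → a ≢ fromℕ (suc m) → inject₁ (pinch (fromℕ m) a) ≡ a
inject₁-pinch Fin.zero _ = refl
inject₁-pinch {zero} (Fin.suc Fin.zero) a≢max = contradiction refl a≢max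
inject₁-pinch {suc m} (Fin.suc a) a≢max = cong Fin.suc (inject₁-pinch a (a≢max ∘ cong Fin.suc))

lowerAll-inject₁ : ∀ {n} (π : Vec (Fin n) n) → lowerAll (Vec.map inject₁ π) ≡ π
lowerAll-inject₁ {zero} [] = refl
lowerAll-inject₁ {suc n} π =
  trans (sym (Vec.map-∘ _ inject₁ π)) (trans (Vec.map-cong pinch-inject₁ π) (Vec.map-id π))

inject₁-lowerAll : ∀ {n} (v : Vec (Fin (suc n)) n) → (∀ j → lookup v j ≢ fromℕ n) →
  Vec.map inject₁ (lowerAll v) ≡ v
inject₁-lowerAll {zero} [] _ = refl
inject₁-lowerAll {suc n} v = raise v
  where
  raise : ∀ {k} (w : Vec (Fin (suc (suc n))) k) → (∀ j → lookup w j ≢ fromℕ (suc n)) →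
    Vec.map inject₁ (Vec.map (pinch (fromℕ n)) w) ≡ w
  raise [] _ = refl
  raise (a ∷ w) w≢max = cong₂ _∷_ (inject₁-pinch a (w≢max Fin.zero)) (raise w (w≢max ∘ Fin.suc))

lookup-removeAt : ∀ {m} (xs : Vec A (suc m)) p j → lookup (removeAt xs p) j ≡ lookup xs (punchIn p j)
lookup-removeAt xs p j = trans (cong (lookup (removeAt xs p)) (sym (Fin.punchOut-punchIn p)))
                               (Vec.removeAt-punchOut xs (Fin.punchInᵢ≢i p j ∘ sym))

module _ {n} (π : Vec (Fin (suc n)) (suc n)) (inj : Injective _≡_ _≡_ (lookup π)) where
  private
    p = maxPosition π
    rest = removeAt π p

    rest≢max : ∀ j → lookup rest j ≢ fromℕ n
    rest≢max j eq =
      Fin.punchInᵢ≢i p j (inj (trans (sym (lookup-removeAt π p j)) (trans eq (sym (lookup-maxPosition π inj)))))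

    inject₁-lookup-lowerAll : ∀ j → inject₁ (lookup (lowerAll rest) j) ≡ lookup π (punchIn p j)
    inject₁-lookup-lowerAll j = begin
      inject₁ (lookup (lowerAll rest) j)
        ≡⟨ Vec.lookup-map j inject₁ (lowerAll rest) ⟨
      lookup (Vec.map inject₁ (lowerAll rest)) j
        ≡⟨ cong (λ v → lookup v j) (inject₁-lowerAll rest rest≢max) ⟩
      lookup rest j
        ≡⟨ lookup-removeAt π p j ⟩
      lookup π (punchIn p j) ∎

  removeMax-injective : Injective _≡_ _≡_ (lookup (lowerAll (removeAt π (maxPosition π))))
  removeMax-injective {j} {j′} eq = Fin.punchIn-injective p j j′
    (inj (trans (sym (inject₁-lookup-lowerAll j)) (trans (cong inject₁ eq) (inject₁-lookup-lowerAll j′))))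

  insertMax-removeMax : insertMax (maxPosition π) (lowerAll (removeAt π (maxPosition π))) ≡ π
  insertMax-removeMax = begin
    insertAt (Vec.map inject₁ (lowerAll rest)) p (fromℕ n)
      ≡⟨ cong₂ (λ v a → insertAt v p a) (inject₁-lowerAll rest rest≢max) (sym (lookup-maxPosition π inj)) ⟩
    insertAt rest p (lookup π p)
      ≡⟨ Vec.insertAt-removeAt π p ⟩
    π ∎

remove : ∀ {c n} → ColPerm c (suc n) → Insertion c n
remove (π , cs) = let p = maxPosition π in (p , lookup cs p) , (lowerAll (removeAt π p) , removeAt cs p)

remove∘insert : ∀ {c n} (y : Insertion c n) → remove (insert y) ≡ y
remove∘insert ((p , m) , (π , cs)) rewrite maxPosition-insertMax p π =
  cong₂ _,_ (cong (p ,_) (Vec.insertAt-lookup cs p m))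
            (cong₂ _,_ (trans (cong lowerAll (Vec.removeAt-insertAt (Vec.map inject₁ π) p (fromℕ _)))
                              (lowerAll-inject₁ π))
                       (Vec.removeAt-insertAt cs p m))

insert∘remove : ∀ {c n} (σ : ColPerm c (suc n)) → Injective _≡_ _≡_ (lookup (proj₁ σ)) → insert (remove σ) ≡ σ
insert∘remove (π , cs) inj = cong₂ _,_ (insertMax-removeMax π inj) (Vec.insertAt-removeAt cs (maxPosition π))

insert-isPerm : ∀ {c n} (y : Insertion c n) → isPerm (proj₁ (proj₂ y)) ≡ true → isPerm (proj₁ (insert y)) ≡ true
insert-isPerm ((p , m) , (π , cs)) perm =
  injective⇒isPerm (insertMax p π) (insertMax-injective p π (isPerm⇒injective π perm))

remove-isPerm : ∀ {c n} (σ : ColPerm c (suc n)) →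
  isPerm (proj₁ σ) ≡ true → isPerm (proj₁ (proj₂ (remove σ))) ≡ true
remove-isPerm (π , cs) perm =
  injective⇒isPerm (lowerAll (removeAt π (maxPosition π))) (removeMax-injective π (isPerm⇒injective π perm))

insertionsᴱ : ∀ c n → Enumeration (Insertion c n)
insertionsᴱ c n = (finᴱ (suc n) ×ᴱ finᴱ c) ×ᴱ colouredWordsᴱ c n

𝟙-+-≟ : ∀ a w k → 𝟙 (does (a + w ℕ.≟ k)) ≡ (if w ≤ᵇ k then 𝟙 (does (a ℕ.≟ k ∸ w)) else 0)
𝟙-+-≟ a w k with w ≤ᵇ k | ≤ᵇ-reflects-≤ w k
... | true | ofʸ w≤k = cong 𝟙 (does-⇔ (mk⇔ (λ a+w≡k → trans (sym (m+n∸n≡m a w)) (cong (_∸ w) a+w≡k))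
                                            (λ a≡k∸w → trans (cong (_+ w) a≡k∸w) (m∸n+n≡m w≤k)))
                                       (a + w ℕ.≟ k) (a ℕ.≟ k ∸ w))
... | false | ofⁿ w≰k = cong 𝟙 (dec-false (a + w ℕ.≟ k) (λ a+w≡k → w≰k (subst (w ≤_) a+w≡k (m≤n+m w a))))

ic-insertion : ∀ c n k → ic c (suc n) k ≡
  ∑[ p ∈ allFin (suc n) ] ∑[ m ∈ allFin c ]
    (let w = weight n c (toℕ p) (toℕ m) in if w ≤ᵇ k then ic c n (k ∸ w) else 0)
ic-insertion c n k = begin
  ic c (suc n) k
    ≡⟨ ic≡sum c (suc n) k ⟩
  ∑[ σ ∈ elements (colouredWordsᴱ c (suc n)) ] (𝟙 (isPerm (proj₁ σ)) * 𝟙 (does (invc σ ℕ.≟ k)))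
    ≡⟨ sum-bijection (colouredWordsᴱ c (suc n)) (insertionsᴱ c n) (isPerm ∘ proj₁) (isPerm ∘ proj₁ ∘ proj₂)
         insert remove insert-isPerm remove-isPerm (λ y _ → remove∘insert y)
         (λ σ perm → insert∘remove σ (isPerm⇒injective (proj₁ σ) perm)) (λ σ → 𝟙 (does (invc σ ℕ.≟ k))) ⟩
  ∑[ y ∈ elements (insertionsᴱ c n) ] (𝟙 (isPerm (proj₁ (proj₂ y))) * 𝟙 (does (invc (insert y) ℕ.≟ k)))
    ≡⟨ sumOver-cong (elements (insertionsᴱ c n))
         (λ y → cong (λ e → 𝟙 (isPerm (proj₁ (proj₂ y))) * 𝟙 (does (e ℕ.≟ k))) (invc-insert y)) ⟩
  ∑[ y ∈ elements (insertionsᴱ c n) ]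
    (𝟙 (isPerm (proj₁ (proj₂ y))) * 𝟙 (does (invc (proj₂ y) + W (proj₁ y) ℕ.≟ k)))
    ≡⟨ sumOver-cartesianProduct pms σs _ ⟩
  ∑[ pm ∈ pms ] ∑[ σ ∈ σs ] (𝟙 (isPerm (proj₁ σ)) * 𝟙 (does (invc σ + W pm ℕ.≟ k)))
    ≡⟨ sumOver-cong pms (λ pm →
         trans (sumOver-cong σs (λ σ → cong (𝟙 (isPerm (proj₁ σ)) *_) (𝟙-+-≟ (invc σ) (W pm) k)))
               (sumOver-if σs (𝟙 ∘ isPerm ∘ proj₁) (λ σ → 𝟙 (does (invc σ ℕ.≟ k ∸ W pm))) (W pm ≤ᵇ k))) ⟩
  ∑[ pm ∈ pms ] (if W pm ≤ᵇ k then ∑[ σ ∈ σs ] (𝟙 (isPerm (proj₁ σ)) * 𝟙 (does (invc σ ℕ.≟ k ∸ W pm))) else 0)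
    ≡⟨ sumOver-cong pms (λ pm → cong (if W pm ≤ᵇ k then_else 0) (sym (ic≡sum c n (k ∸ W pm)))) ⟩
  ∑[ pm ∈ pms ] (if W pm ≤ᵇ k then ic c n (k ∸ W pm) else 0)
    ≡⟨ sumOver-cartesianProduct (allFin (suc n)) (allFin c) _ ⟩
  _ ∎
  where
  pms = cartesianProduct (allFin (suc n)) (allFin c)
  σs = elements (colouredWordsᴱ c n)
  W : Fin (suc n) × Fin c → ℕ
  W (p , m) = weight n c (toℕ p) (toℕ m)

weight-zero : ∀ n c p → weight n c p 0 ≡ n ∸ p
weight-zero n c p rewrite *-zeroʳ p | *-zeroʳ c = trans (+-identityʳ _) (+-identityʳ (n ∸ p))

weight-suc : ∀ n c p m → p ≤ n → weight n (suc c) p (suc m) ≡ suc n + (m + c * p)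
weight-suc n c p m p≤n = begin
  (n ∸ p) + suc m + suc c * (p * 1)
    ≡⟨ solveℕ 4 (λ d m c p → d ⊕ (κ 1 ⊕ m) ⊕ (κ 1 ⊕ c) ⊛ (p ⊛ κ 1) ⊜ κ 1 ⊕ (d ⊕ p) ⊕ (m ⊕ c ⊛ p))
         refl (n ∸ p) m c p ⟩
  suc (n ∸ p + p) + (m + c * p)
    ≡⟨ cong (λ x → suc x + (m + c * p)) (m∸n+n≡m p≤n) ⟩
  suc n + (m + c * p) ∎

sum-weights : ∀ n c (f : ℕ → ℕ) →
  sumℕ (suc n) (λ p → sumℕ (suc c) (λ m → f (weight n (suc c) p m))) ≡ sumℕ (suc c * suc n) f
sum-weights n c f = begin
  sumℕ (suc n) (λ p → sumℕ (suc c) (λ m → f (weight n (suc c) p m)))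
    ≡⟨ sumℕ-cong (suc n) (λ p p≤n → trans (sumℕ-cons c (λ m → f (weight n (suc c) p m)))
         (cong₂ _+_ (cong f (weight-zero n (suc c) p))
                    (sumℕ-cong c {λ m → f (weight n (suc c) p (suc m))}
                                 (λ m _ → cong f (weight-suc n c p m (≤-pred p≤n)))))) ⟩
  sumℕ (suc n) (λ p → f (n ∸ p) + sumℕ c (λ m → f (suc n + (m + c * p))))
    ≡⟨ sumℕ-+ (suc n) _ _ ⟩
  sumℕ (suc n) (λ p → f (n ∸ p)) + sumℕ (suc n) (λ p → sumℕ c (λ m → f (suc n + (m + c * p))))
    ≡⟨ cong₂ _+_ (sumℕ-reverse n f) (sumℕ-blocks (suc n) c (λ e → f (suc n + e))) ⟩
  sumℕ (suc n) f + sumℕ (c * suc n) (λ e → f (suc n + e))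
    ≡⟨ sumℕ-split (suc n) (c * suc n) f ⟨
  sumℕ (suc c * suc n) f ∎

ic-suc : ∀ {c} n k → 1 ≤ c → ic c (suc n) k ≡ sumℕ (c * suc n) (λ e → if e ≤ᵇ k then ic c n (k ∸ e) else 0)
ic-suc {suc c} n k _ = begin
  ic (suc c) (suc n) k
    ≡⟨ ic-insertion (suc c) n k ⟩
  ∑[ p ∈ allFin (suc n) ] ∑[ m ∈ allFin (suc c) ] f (weight n (suc c) (toℕ p) (toℕ m))
    ≡⟨ sumOver-cong (allFin (suc n)) (λ p → sumOver-allFin (suc c) (λ m → f (weight n (suc c) (toℕ p) m))) ⟩
  ∑[ p ∈ allFin (suc n) ] sumℕ (suc c) (λ m → f (weight n (suc c) (toℕ p) m))
    ≡⟨ sumOver-allFin (suc n) (λ p → sumℕ (suc c) (λ m → f (weight n (suc c) p m))) ⟩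
  sumℕ (suc n) (λ p → sumℕ (suc c) (λ m → f (weight n (suc c) p m)))
    ≡⟨ sum-weights n c f ⟩
  sumℕ (suc c * suc n) f ∎
  where
  f : ℕ → ℕ
  f e = if e ≤ᵇ k then ic (suc c) n (k ∸ e) else 0

-- Power series

-- f : Series stands for Σᵢ f i xⁱ; x· and x^ e · multiply by x and xᵉ, prefixSums divides by 1 − x.
Series : Set
Series = ℕ → ℤ

infixl 6 _⊖_
_⊖_ : Series → Series → Series
(f ⊖ g) i = f i ℤ.- g i

x·_ : Series → Series
(x· f) zero = + 0
(x· f) (suc i) = f i

x^_·_ : ℕ → Series → Series
x^ zero · f = f
x^ suc e · f = x· (x^ e · f)

x·-cong : ∀ {f g} → f ≗ g → x· f ≗ x· g
x·-cong f≗g zero = refl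
x·-cong f≗g (suc i) = f≗g i

x·-⊖ : ∀ f g → x· (f ⊖ g) ≗ x· f ⊖ x· g
x·-⊖ f g zero = refl
x·-⊖ f g (suc i) = refl

x^·-cong : ∀ e {f g} → f ≗ g → x^ e · f ≗ x^ e · g
x^·-cong zero f≗g = f≗g
x^·-cong (suc e) f≗g = x·-cong (x^·-cong e f≗g)

x^·-⊖ : ∀ e f g → x^ e · (f ⊖ g) ≗ x^ e · f ⊖ x^ e · g
x^·-⊖ zero f g i = refl
x^·-⊖ (suc e) f g i = trans (x·-cong (x^·-⊖ e f g) i) (x·-⊖ (x^ e · f) (x^ e · g) i)

x^·-x^· : ∀ a b f → x^ a · (x^ b · f) ≡ x^ (a + b) · f
x^·-x^· zero b f = refl
x^·-x^· (suc a) b f = cong x·_ (x^·-x^· a b f)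

x^·-< : ∀ {e i} f → i < e → (x^ e · f) i ≡ + 0
x^·-< {suc e} {zero} f _ = refl
x^·-< {suc e} {suc i} f (s≤s i<e) = x^·-< f i<e

x^·-apply : ∀ e f i → (x^ e · f) i ≡ (if e ≤ᵇ i then f (i ∸ e) else + 0)
x^·-apply zero f i = refl
x^·-apply (suc e) f zero = refl
x^·-apply (suc zero) f (suc i) = refl
x^·-apply (suc (suc e)) f (suc i) = x^·-apply (suc e) f i

prefixSums : Series → Series
prefixSums f zero = f 0
prefixSums f (suc i) = prefixSums f i ℤ.+ f (suc i)

prefixSums-cong : ∀ {f g} → f ≗ g → prefixSums f ≗ prefixSums g
prefixSums-cong f≗g zero = f≗g 0
prefixSums-cong f≗g (suc i) = cong₂ ℤ._+_ (prefixSums-cong f≗g i) (f≗g (suc i))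

prefixSums-⊖ : ∀ f g → prefixSums (f ⊖ g) ≗ prefixSums f ⊖ prefixSums g
prefixSums-⊖ f g zero = refl
prefixSums-⊖ f g (suc i) rewrite prefixSums-⊖ f g i =
  solve 4 (λ a b c d → (a :- b) :+ (c :- d) := (a :+ c) :- (b :+ d)) refl
    (prefixSums f i) (prefixSums g i) (f (suc i)) (g (suc i))

prefixSums-x· : ∀ f → prefixSums (x· f) ≗ x· prefixSums f
prefixSums-x· f zero = refl
prefixSums-x· f (suc zero) = ℤ.+-identityˡ (f 0)
prefixSums-x· f (suc (suc i)) = cong (ℤ._+ f (suc i)) (prefixSums-x· f (suc i))

prefixSums-x^· : ∀ e f → prefixSums (x^ e · f) ≗ x^ e · prefixSums f
prefixSums-x^· zero f i = refl
prefixSums-x^· (suc e) f i = trans (prefixSums-x· (x^ e · f) i) (x·-cong (prefixSums-x^· e f) i)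

prefixSums-difference : ∀ f → prefixSums f ⊖ x· prefixSums f ≗ f
prefixSums-difference f zero = ℤ.+-identityʳ (f 0)
prefixSums-difference f (suc i) = solve 2 (λ s a → (s :+ a) :- s := a) refl (prefixSums f i) (f (suc i))

geometric : ∀ m f → (λ i → sumℤ m (λ e → (x^ e · f) i)) ≗ prefixSums f ⊖ x^ m · prefixSums f
geometric zero f i = sym (ℤ.+-inverseʳ (prefixSums f i))
geometric (suc m) f i = begin
  sumℤ m (λ e → (x^ e · f) i) ℤ.+ (x^ m · f) i
    ≡⟨ cong₂ ℤ._+_ (geometric m f i) (x^·-cong m (sym ∘ prefixSums-difference f) i) ⟩
  (F i ℤ.- (x^ m · F) i) ℤ.+ (x^ m · (F ⊖ x· F)) i
    ≡⟨ cong (λ z → (F i ℤ.- (x^ m · F) i) ℤ.+ z) (x^·-⊖ m F (x· F) i) ⟩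
  (F i ℤ.- (x^ m · F) i) ℤ.+ ((x^ m · F) i ℤ.- (x^ m · (x· F)) i)
    ≡⟨ solve 3 (λ a b c → (a :- b) :+ (b :- c) := a :- c) refl (F i) ((x^ m · F) i) ((x^ m · (x· F)) i) ⟩
  F i ℤ.- (x^ m · (x· F)) i
    ≡⟨ cong (λ g → F i ℤ.- g i) (trans (x^·-x^· m 1 F) (cong (x^_· F) (+-comm m 1))) ⟩
  F i ℤ.- (x^ suc m · F) i ∎
  where F = prefixSums f

binomials : ℕ → Series
binomials n i = + ((n + i ∸ 1) C i)

binomials-zero : ∀ k → binomials 0 k ≡ + 𝟙 (does (0 ℕ.≟ k))
binomials-zero zero = refl
binomials-zero (suc k) = cong +_ (k>n⇒nCk≡0 (n<1+n k))

prefixSums-binomials : ∀ n → prefixSums (binomials n) ≗ binomials (suc n)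
prefixSums-binomials n zero = refl
prefixSums-binomials n (suc i) = begin
  prefixSums (binomials n) i ℤ.+ binomials n (suc i)
    ≡⟨ cong (ℤ._+ binomials n (suc i)) (prefixSums-binomials n i) ⟩
  + ((n + i) C i) ℤ.+ + ((n + suc i ∸ 1) C suc i)
    ≡⟨ ℤ.pos-+ ((n + i) C i) _ ⟨
  + ((n + i) C i + (n + suc i ∸ 1) C suc i)
    ≡⟨ cong (λ t → + ((n + i) C i + (t ∸ 1) C suc i)) (+-suc n i) ⟩
  + ((n + i) C i + (n + i) C suc i)
    ≡⟨ cong +_ (nCk+nC[k+1]≡[n+1]C[k+1] (n + i) i) ⟩
  + (suc (n + i) C suc i)
    ≡⟨ cong (λ t → + (t C suc i)) (+-suc n i) ⟨
  binomials (suc n) (suc i) ∎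

x^·-binomials : ∀ n s K → (x^ s · binomials (suc n)) K ≡ + shiftedBinom (suc n) K s
x^·-binomials n s K = trans (x^·-apply s (binomials (suc n)) K) (sym (if-float +_ (s ≤ᵇ K)))

shiftedBinom-vanishes : ∀ n K s → K < s → shiftedBinom n K s ≡ 0
shiftedBinom-vanishes n K s K<s rewrite dec-false (s ℕ.≤? K) (<⇒≱ K<s) = refl

-- Shanks' identity

triangular : ℕ → ℕ
triangular zero = 0
triangular (suc k) = triangular k + suc k

pent-suc : ∀ j → pent (suc j) ≡ pent j + suc (3 * j)
pent-suc zero = refl
pent-suc (suc i) = begin
  (suc (suc i) * (3 * suc (suc i) ∸ 1)) / 2
    ≡⟨ cong (λ t → (suc (suc i) * t) / 2) (3*suc∸1 (suc i)) ⟩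
  (suc (suc i) * (2 + 3 * suc i)) / 2
    ≡⟨ cong (_/ 2) (solveℕ 1 (λ i → (κ 2 ⊕ i) ⊛ (κ 2 ⊕ κ 3 ⊛ (κ 1 ⊕ i))
                                   ⊜ (κ 1 ⊕ i) ⊛ (κ 2 ⊕ κ 3 ⊛ i) ⊕ (κ 1 ⊕ κ 3 ⊛ (κ 1 ⊕ i)) ⊛ κ 2) refl i) ⟩
  (suc i * (2 + 3 * i) + suc (3 * suc i) * 2) / 2
    ≡⟨ +-distrib-/-∣ʳ (suc i * (2 + 3 * i)) {d = 2} (divides-refl (suc (3 * suc i))) ⟩
  (suc i * (2 + 3 * i)) / 2 + suc (3 * suc i) * 2 / 2
    ≡⟨ cong₂ _+_ (cong (λ t → (suc i * t) / 2) (sym (3*suc∸1 i))) (m*n/n≡m (suc (3 * suc i)) 2) ⟩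
  pent (suc i) + suc (3 * suc i) ∎
  where
  3*suc∸1 : ∀ m → 3 * suc m ∸ 1 ≡ 2 + 3 * m
  3*suc∸1 m = cong (_∸ 1) (*-suc 3 m)

pent≡square+triangular : ∀ N → pent (suc N) ≡ suc N * suc N + triangular N
pent≡square+triangular zero = refl
pent≡square+triangular (suc N) = begin
  pent (suc (suc N))
    ≡⟨ pent-suc (suc N) ⟩
  pent (suc N) + suc (3 * suc N)
    ≡⟨ cong (_+ suc (3 * suc N)) (pent≡square+triangular N) ⟩
  suc N * suc N + triangular N + suc (3 * suc N)
    ≡⟨ solveℕ 2 (λ N t → (κ 1 ⊕ N) ⊛ (κ 1 ⊕ N) ⊕ t ⊕ (κ 1 ⊕ κ 3 ⊛ (κ 1 ⊕ N))
                        ⊜ (κ 2 ⊕ N) ⊛ (κ 2 ⊕ N) ⊕ (t ⊕ (κ 1 ⊕ N))) refl N (triangular N) ⟩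
  suc (suc N) * suc (suc N) + triangular (suc N) ∎

j≤pent : ∀ j → j ≤ pent j
j≤pent zero = z≤n
j≤pent (suc j) rewrite pent-suc j | +-suc (pent j) (3 * j) = s≤s (≤-trans (j≤pent j) (m≤m+n (pent j) (3 * j)))

-- y^_·_ may be any action of (ℕ, +) on series by additive maps; the theorem uses y^ e · f = x^ (c e) · f.
module Shanks
  (y^_·_ : ℕ → Series → Series)
  (y^·-cong : ∀ e {f g} → f ≗ g → y^ e · f ≗ y^ e · g)
  (y^·-⊖ : ∀ e f g → y^ e · (f ⊖ g) ≗ (y^ e · f) ⊖ (y^ e · g))
  (y^0· : ∀ f → y^ 0 · f ≗ f)
  (y^·-y^· : ∀ a b f → y^ a · (y^ b · f) ≗ y^ (a + b) · f)
  where

  y^·-y^·≡ : ∀ {a b e} f → a + b ≡ e → y^ a · (y^ b · f) ≗ y^ e · f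
  y^·-y^·≡ f refl = y^·-y^· _ _ f

  y^·-comm : ∀ a b f → y^ a · (y^ b · f) ≗ y^ b · (y^ a · f)
  y^·-comm a b f i = trans (y^·-y^·≡ f (+-comm a b) i) (sym (y^·-y^· b a f i))

  ⟨1-y^_⟩·_ : ℕ → Series → Series
  ⟨1-y^ e ⟩· f = f ⊖ (y^ e · f)

  ⟨1-y^⟩·-cong : ∀ e {f g} → f ≗ g → ⟨1-y^ e ⟩· f ≗ ⟨1-y^ e ⟩· g
  ⟨1-y^⟩·-cong e f≗g i = cong₂ ℤ._-_ (f≗g i) (y^·-cong e f≗g i)

  ⟨1-y^⟩·-⊖ : ∀ e f g → ⟨1-y^ e ⟩· (f ⊖ g) ≗ (⟨1-y^ e ⟩· f) ⊖ (⟨1-y^ e ⟩· g)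
  ⟨1-y^⟩·-⊖ e f g i rewrite y^·-⊖ e f g i =
    solve 4 (λ a b c d → (a :- b) :- (c :- d) := (a :- c) :- (b :- d)) refl
      (f i) (g i) ((y^ e · f) i) ((y^ e · g) i)

  ⟨1-y^⟩·-y^· : ∀ d e f → ⟨1-y^ d ⟩· (y^ e · f) ≗ y^ e · (⟨1-y^ d ⟩· f)
  ⟨1-y^⟩·-y^· d e f i =
    trans (cong (λ z → (y^ e · f) i ℤ.- z) (y^·-comm d e f i)) (sym (y^·-⊖ e f (y^ d · f) i))

  -- poch a l f is f multiplied by the q-Pochhammer symbol (y^(a+1); y)_l = (1 − y^(a+1)) ⋯ (1 − y^(a+l)).
  poch : ℕ → ℕ → Series → Series
  poch a zero f = f
  poch a (suc l) f = ⟨1-y^ suc a ⟩· poch (suc a) l f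

  poch-cong : ∀ a l {f g} → f ≗ g → poch a l f ≗ poch a l g
  poch-cong a zero f≗g = f≗g
  poch-cong a (suc l) f≗g = ⟨1-y^⟩·-cong (suc a) (poch-cong (suc a) l f≗g)

  poch-⊖ : ∀ a l f g → poch a l (f ⊖ g) ≗ poch a l f ⊖ poch a l g
  poch-⊖ a zero f g i = refl
  poch-⊖ a (suc l) f g i =
    trans (⟨1-y^⟩·-cong (suc a) (poch-⊖ (suc a) l f g) i)
          (⟨1-y^⟩·-⊖ (suc a) (poch (suc a) l f) (poch (suc a) l g) i)

  module _ (L : Series → Series)
           (L-cong : ∀ {f g} → f ≗ g → L f ≗ L g)
           (L-⊖ : ∀ f g → L (f ⊖ g) ≗ L f ⊖ L g)
           (L-y^· : ∀ e f → L (y^ e · f) ≗ y^ e · L f)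
    where

    poch-commute : ∀ a l f → L (poch a l f) ≗ poch a l (L f)
    poch-commute a zero f i = refl
    poch-commute a (suc l) f i = trans (L-⊖ _ _ i)
      (cong₂ ℤ._-_ (poch-commute (suc a) l f i)
                   (trans (L-y^· (suc a) _ i) (y^·-cong (suc a) (poch-commute (suc a) l f) i)))

  poch-y^· : ∀ d a l f → y^ d · poch a l f ≗ poch a l (y^ d · f)
  poch-y^· d = poch-commute (y^ d ·_) (y^·-cong d) (y^·-⊖ d) (y^·-comm d)

  poch-⟨1-y^⟩· : ∀ d a l f → ⟨1-y^ d ⟩· poch a l f ≗ poch a l (⟨1-y^ d ⟩· f)
  poch-⟨1-y^⟩· d = poch-commute (⟨1-y^ d ⟩·_) (⟨1-y^⟩·-cong d) (⟨1-y^⟩·-⊖ d) (⟨1-y^⟩·-y^· d)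

  poch-snoc : ∀ a l f → poch a (suc l) f ≗ poch a l (⟨1-y^ a + suc l ⟩· f)
  poch-snoc a zero f i = cong (λ e → (⟨1-y^ e ⟩· f) i) (+-comm 1 a)
  poch-snoc a (suc l) f i = trans (⟨1-y^⟩·-cong (suc a) (poch-snoc (suc a) l f) i)
    (cong (λ e → poch a (suc l) (⟨1-y^ e ⟩· f) i) (sym (+-suc a (suc l))))

  shanksTerm : ℕ → ℕ → Series → Series
  shanksTerm N k f = poch k (N ∸ k) (y^ (N * k + triangular k) · f)

  shanksSum : ℕ → Series → Series
  shanksSum N f i = sumℤ (suc N) (λ k → sign k ℤ.* shanksTerm N k f i)

  pentagonalSum : ℕ → Series → Series
  pentagonalSum N f i = f i ℤ.+ sumFrom1 N (λ j → sign j ℤ.* ((y^ pent j · f) i ℤ.+ (y^ (pent j + j) · f) i))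

  shanksTerm-suc : ∀ N k f → k ≤ N → shanksTerm (suc N) k f ≗ ⟨1-y^ suc N ⟩· (y^ k · shanksTerm N k f)
  shanksTerm-suc N k f k≤N i = begin
    poch k (suc N ∸ k) h i
      ≡⟨ cong (λ l → poch k l h i) (+-∸-assoc 1 k≤N) ⟩
    poch k (suc (N ∸ k)) h i
      ≡⟨ poch-snoc k (N ∸ k) h i ⟩
    poch k (N ∸ k) (⟨1-y^ k + suc (N ∸ k) ⟩· h) i
      ≡⟨ cong (λ e → poch k (N ∸ k) (⟨1-y^ e ⟩· h) i) (trans (+-suc k (N ∸ k)) (cong suc (m+[n∸m]≡n k≤N))) ⟩
    poch k (N ∸ k) (⟨1-y^ suc N ⟩· h) i
      ≡⟨ poch-cong k (N ∸ k) (⟨1-y^⟩·-cong (suc N) (λ j → sym (y^·-y^·≡ f (sym (+-assoc k (N * k) _)) j))) i ⟩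
    poch k (N ∸ k) (⟨1-y^ suc N ⟩· (y^ k · (y^ (N * k + triangular k) · f))) i
      ≡⟨ poch-⟨1-y^⟩· (suc N) k (N ∸ k) _ i ⟨
    (⟨1-y^ suc N ⟩· poch k (N ∸ k) (y^ k · (y^ (N * k + triangular k) · f))) i
      ≡⟨ ⟨1-y^⟩·-cong (suc N) (λ j → sym (poch-y^· k k (N ∸ k) _ j)) i ⟩
    (⟨1-y^ suc N ⟩· (y^ k · shanksTerm N k f)) i ∎
    where
    h = y^ (suc N * k + triangular k) · f

  shanksTerm-step : ∀ N k f → k < N →
    y^ suc N · (y^ k · shanksTerm N k f) ≗ ⟨1-y^ suc k ⟩· shanksTerm N (suc k) f
  shanksTerm-step N k f k<N i = begin
    (y^ suc N · (y^ k · poch k (N ∸ k) (y^ (N * k + triangular k) · f))) i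
      ≡⟨ y^·-cong (suc N) (poch-y^· k k (N ∸ k) _) i ⟩
    (y^ suc N · poch k (N ∸ k) (y^ k · (y^ (N * k + triangular k) · f))) i
      ≡⟨ poch-y^· (suc N) k (N ∸ k) _ i ⟩
    poch k (N ∸ k) (y^ suc N · (y^ k · (y^ (N * k + triangular k) · f))) i
      ≡⟨ poch-cong k (N ∸ k) (λ j → trans (y^·-cong (suc N) (y^·-y^· k _ f) j) (y^·-y^·≡ f exponent j)) i ⟩
    poch k (N ∸ k) (y^ (N * suc k + triangular (suc k)) · f) i
      ≡⟨ cong (λ l → poch k l (y^ (N * suc k + triangular (suc k)) · f) i) (+-∸-assoc 1 k<N) ⟩
    (⟨1-y^ suc k ⟩· shanksTerm N (suc k) f) i ∎
    where
    exponent : suc N + (k + (N * k + triangular k)) ≡ N * suc k + triangular (suc k)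
    exponent = solveℕ 3 (λ N k t → (κ 1 ⊕ N) ⊕ (k ⊕ (N ⊛ k ⊕ t)) ⊜ N ⊛ (κ 1 ⊕ k) ⊕ (t ⊕ (κ 1 ⊕ k)))
                 refl N k (triangular k)

  shanksTerm-diagonal : ∀ N f → shanksTerm N N f ≗ y^ (N * N + triangular N) · f
  shanksTerm-diagonal N f i = cong (λ l → poch N l (y^ (N * N + triangular N) · f) i) (n∸n≡0 N)

  -- Splitting the factor 1 − y^(N+1) off every term of shanksSum (N + 1) makes the difference telescope.
  shanksSum-suc : ∀ N f i → shanksSum (suc N) f i ≡
    shanksSum N f i ℤ.+ sign (suc N) ℤ.* ((y^ pent (suc N) · f) i ℤ.+ (y^ (pent (suc N) + suc N) · f) i)
  shanksSum-suc N f i = begin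
    sumℤ (suc N) (λ k → sign k ℤ.* shanksTerm (suc N) k f i) ℤ.+ sign (suc N) ℤ.* shanksTerm (suc N) (suc N) f i
      ≡⟨ cong₂ (λ s t → s ℤ.+ sign (suc N) ℤ.* t)
           (sumℤ-cong (suc N) (λ k k≤N → cong (sign k ℤ.*_) (shanksTerm-suc N k f (≤-pred k≤N) i))) top ⟩
    sumℤ (suc N) (λ k → sign k ℤ.* (Z k ℤ.- X k)) ℤ.+ sign (suc N) ℤ.* Q
      ≡⟨ cong (ℤ._+ sign (suc N) ℤ.* Q) (alternating-telescope N Z Y X (y^0· _ i) Z≡Y-X) ⟩
    (shanksSum N f i ℤ.- sign N ℤ.* X N) ℤ.+ ℤ.- sign N ℤ.* Q
      ≡⟨ cong (λ t → (shanksSum N f i ℤ.- sign N ℤ.* t) ℤ.+ ℤ.- sign N ℤ.* Q) X-last ⟩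
    (shanksSum N f i ℤ.- sign N ℤ.* P) ℤ.+ ℤ.- sign N ℤ.* Q
      ≡⟨ solve 4 (λ S s p q → (S :- s :* p) :+ (:- s) :* q := S :+ (:- s) :* (p :+ q)) refl
           (shanksSum N f i) (sign N) P Q ⟩
    shanksSum N f i ℤ.+ sign (suc N) ℤ.* (P ℤ.+ Q) ∎
    where
    P = (y^ pent (suc N) · f) i
    Q = (y^ (pent (suc N) + suc N) · f) i
    Y Z X : ℕ → ℤ
    Y k = shanksTerm N k f i
    Z k = (y^ k · shanksTerm N k f) i
    X k = (y^ suc N · (y^ k · shanksTerm N k f)) i

    Z≡Y-X : ∀ k → k < N → Z (suc k) ≡ Y (suc k) ℤ.- X k
    Z≡Y-X k k<N = begin
      Z (suc k)
        ≡⟨ solve 2 (λ y z → z := y :- (y :- z)) refl (Y (suc k)) (Z (suc k)) ⟩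
      Y (suc k) ℤ.- (Y (suc k) ℤ.- Z (suc k))
        ≡⟨ cong (λ t → Y (suc k) ℤ.- t) (shanksTerm-step N k f k<N i) ⟨
      Y (suc k) ℤ.- X k ∎

    X-last : X N ≡ P
    X-last = begin
      (y^ suc N · (y^ N · shanksTerm N N f)) i
        ≡⟨ y^·-cong (suc N) (y^·-cong N (shanksTerm-diagonal N f)) i ⟩
      (y^ suc N · (y^ N · (y^ (N * N + triangular N) · f))) i
        ≡⟨ trans (y^·-cong (suc N) (y^·-y^· N _ f) i) (y^·-y^· (suc N) _ f i) ⟩
      (y^ (suc N + (N + (N * N + triangular N))) · f) i
        ≡⟨ cong (λ e → (y^ e · f) i) (trans exponent (sym (pent≡square+triangular N))) ⟩
      P ∎
      where
      exponent : suc N + (N + (N * N + triangular N)) ≡ suc N * suc N + triangular N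
      exponent = solveℕ 2 (λ N t → (κ 1 ⊕ N) ⊕ (N ⊕ (N ⊛ N ⊕ t)) ⊜ (κ 1 ⊕ N) ⊛ (κ 1 ⊕ N) ⊕ t)
                   refl N (triangular N)

    top : shanksTerm (suc N) (suc N) f i ≡ Q
    top = trans (shanksTerm-diagonal (suc N) f i) (cong (λ e → (y^ e · f) i)
      (trans (sym (+-assoc (suc N * suc N) (triangular N) (suc N)))
             (cong (_+ suc N) (sym (pent≡square+triangular N)))))

  shanks : ∀ N f → shanksSum N f ≗ pentagonalSum N f
  shanks zero f i = trans (solve 1 (λ a → con (+ 0) :+ con (+ 1) :* a := a :+ con (+ 0)) refl ((y^ 0 · f) i))
                          (cong (ℤ._+ + 0) (y^0· f i))
  shanks (suc N) f i = begin
    shanksSum (suc N) f i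
      ≡⟨ shanksSum-suc N f i ⟩
    shanksSum N f i ℤ.+ t
      ≡⟨ cong (ℤ._+ t) (shanks N f i) ⟩
    f i ℤ.+ sumFrom1 N _ ℤ.+ t
      ≡⟨ ℤ.+-assoc (f i) _ t ⟩
    pentagonalSum (suc N) f i ∎
    where
    t = sign (suc N) ℤ.* ((y^ pent (suc N) · f) i ℤ.+ (y^ (pent (suc N) + suc N) · f) i)

pentagonal-truncate : ∀ n K (s : ℕ → ℕ) → K ≤ suc n → (∀ j → j ≤ s j) →
  sumFrom1 (suc n) (λ j → sign j ℤ.* (x^ s j · binomials (suc n)) K)
    ≡ sumFrom1 (suc K) (λ j → sign j ℤ.* + shiftedBinom (suc n) K (s j))
pentagonal-truncate n K s K≤1+n j≤s = begin
  sumFrom1 (suc n) (λ j → sign j ℤ.* (x^ s j · binomials (suc n)) K)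
    ≡⟨ sumFrom1-cong (suc n) (λ j → cong (sign j ℤ.*_) (x^·-binomials n (s j) K)) ⟩
  sumFrom1 (suc n) G   ≡⟨ sumFrom1-truncate G K≤1+n G-vanishes ⟩
  sumFrom1 K G         ≡⟨ sumFrom1-truncate G (n≤1+n K) G-vanishes ⟨
  sumFrom1 (suc K) G   ∎
  where
  G : ℕ → ℤ
  G j = sign j ℤ.* + shiftedBinom (suc n) K (s j)
  G-vanishes : ∀ j → K < j → G j ≡ + 0
  G-vanishes j K<j =
    trans (cong (λ b → sign j ℤ.* + b) (shiftedBinom-vanishes (suc n) K (s j) (<-≤-trans K<j (j≤s j))))
          (ℤ.*-zeroʳ (sign j))

module Coloured (c : ℕ) (c≥1 : 1 ≤ c) where

  x^c·-zero : ∀ f → x^ (c * 0) · f ≗ f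
  x^c·-zero f i = cong (λ e → (x^ e · f) i) (*-zeroʳ c)

  x^c·-x^c· : ∀ a b f → x^ (c * a) · (x^ (c * b) · f) ≗ x^ (c * (a + b)) · f
  x^c·-x^c· a b f i = trans (cong (λ g → g i) (x^·-x^· (c * a) (c * b) f))
                            (cong (λ e → (x^ e · f) i) (sym (*-distribˡ-+ c a b)))

  open Shanks (λ e f → x^ (c * e) · f) (λ e → x^·-cong (c * e)) (λ e → x^·-⊖ (c * e)) x^c·-zero x^c·-x^c· public

  icSeries : ℕ → Series
  icSeries n k = + ic c n k

  poch-prefixSums : ∀ a l f → prefixSums (poch a l f) ≗ poch a l (prefixSums f)
  poch-prefixSums = poch-commute prefixSums prefixSums-cong prefixSums-⊖ (λ e → prefixSums-x^· (c * e))

  icSeries≗poch : ∀ n → icSeries n ≗ poch 0 n (binomials n)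
  icSeries≗poch zero k = trans (cong +_ (ic-zero c k)) (sym (binomials-zero k))
  icSeries≗poch (suc n) k = begin
    + ic c (suc n) k
      ≡⟨ cong +_ (ic-suc n k c≥1) ⟩
    + sumℕ (c * suc n) (λ e → if e ≤ᵇ k then ic c n (k ∸ e) else 0)
      ≡⟨ pos-sumℕ (c * suc n) _ ⟩
    sumℤ (c * suc n) (λ e → + (if e ≤ᵇ k then ic c n (k ∸ e) else 0))
      ≡⟨ sumℤ-cong (c * suc n) (λ e _ → trans (if-float +_ (e ≤ᵇ k)) (sym (x^·-apply e (icSeries n) k))) ⟩
    sumℤ (c * suc n) (λ e → (x^ e · icSeries n) k)
      ≡⟨ geometric (c * suc n) (icSeries n) k ⟩
    (⟨1-y^ suc n ⟩· prefixSums (icSeries n)) k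
      ≡⟨ ⟨1-y^⟩·-cong (suc n) (λ i → trans (prefixSums-cong (icSeries≗poch n) i) (poch-prefixSums 0 n _ i)) k ⟩
    (⟨1-y^ suc n ⟩· poch 0 n (prefixSums (binomials n))) k
      ≡⟨ ⟨1-y^⟩·-cong (suc n) (poch-cong 0 n (prefixSums-binomials n)) k ⟩
    (⟨1-y^ suc n ⟩· poch 0 n (binomials (suc n))) k
      ≡⟨ poch-⟨1-y^⟩· (suc n) 0 n _ k ⟩
    poch 0 n (⟨1-y^ suc n ⟩· binomials (suc n)) k
      ≡⟨ poch-snoc 0 n _ k ⟨
    poch 0 (suc n) (binomials (suc n)) k ∎

  shanksSum≡poch : ∀ n f K → K ≤ n → shanksSum n f K ≡ poch 0 n f K
  shanksSum≡poch n f K K≤n = begin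
    shanksSum n f K
      ≡⟨ sumℤ-leading n _ higher-terms-vanish ⟩
    + 1 ℤ.* poch 0 n (x^ (c * (n * 0 + 0)) · f) K
      ≡⟨ ℤ.*-identityˡ _ ⟩
    poch 0 n (x^ (c * (n * 0 + 0)) · f) K
      ≡⟨ cong (λ e → poch 0 n (x^ (c * e) · f) K) (trans (+-identityʳ (n * 0)) (*-zeroʳ n)) ⟩
    poch 0 n (x^ (c * 0) · f) K
      ≡⟨ poch-cong 0 n (x^c·-zero f) K ⟩
    poch 0 n f K ∎
    where
    higher-terms-vanish : ∀ k → k < n → sign (suc k) ℤ.* shanksTerm n (suc k) f K ≡ + 0
    higher-terms-vanish k _ = begin
      sign (suc k) ℤ.* poch (suc k) (n ∸ suc k) (x^ (c * E) · f) K
        ≡⟨ cong (sign (suc k) ℤ.*_) (poch-y^· E (suc k) (n ∸ suc k) f K) ⟨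
      sign (suc k) ℤ.* (x^ (c * E) · poch (suc k) (n ∸ suc k) f) K
        ≡⟨ cong (sign (suc k) ℤ.*_) (x^·-< _ K<cE) ⟩
      sign (suc k) ℤ.* + 0
        ≡⟨ ℤ.*-zeroʳ (sign (suc k)) ⟩
      + 0 ∎
      where
      E = n * suc k + triangular (suc k)
      K<cE : K < c * E
      K<cE = <-≤-trans (≤-<-trans (≤-trans K≤n (m≤m*n n (suc k)))
                                  (m<m+n (n * suc k) (≤-trans (s≤s z≤n) (m≤n+m (suc k) (triangular k)))))
                       (m≤n*m E c {{>-nonZero c≥1}})

  pentagonalSum≡rhs : ∀ n K → K ≤ suc n → pentagonalSum (suc n) (binomials (suc n)) K ≡ rhs c (suc n) K
  pentagonalSum≡rhs n K K≤1+n = begin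
    bin K ℤ.+ sumFrom1 (suc n) (λ j → sign j ℤ.* (P j ℤ.+ Q j))
      ≡⟨ cong (ℤ._+_ (bin K)) (trans
           (sumFrom1-cong (suc n) (λ j →
              trans (ℤ.*-distribˡ-+ (sign j) (P j) (Q j)) (ℤ.+-comm (sign j ℤ.* P j) (sign j ℤ.* Q j))))
           (sumFrom1-+ (suc n) (λ j → sign j ℤ.* Q j) (λ j → sign j ℤ.* P j))) ⟩
    bin K ℤ.+ (sumFrom1 (suc n) (λ j → sign j ℤ.* Q j) ℤ.+ sumFrom1 (suc n) (λ j → sign j ℤ.* P j))
      ≡⟨ cong (ℤ._+_ (bin K)) (cong₂ ℤ._+_
           (trans (sumFrom1-cong (suc n) (λ j →
                     cong (λ e → sign j ℤ.* (x^ e · bin) K) (*-distribˡ-+ c (pent j) j)))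
                  (pentagonal-truncate n K (λ j → c * pent j + c * j) K≤1+n
                                       (λ j → ≤-trans (j≤c*pent j) (m≤m+n _ _))))
           (pentagonal-truncate n K (λ j → c * pent j) K≤1+n j≤c*pent)) ⟩
    bin K ℤ.+ (S₁ ℤ.+ S₂)
      ≡⟨ ℤ.+-assoc (bin K) S₁ S₂ ⟨
    rhs c (suc n) K ∎
    where
    bin = binomials (suc n)
    P Q : ℕ → ℤ
    P j = (x^ (c * pent j) · bin) K
    Q j = (x^ (c * (pent j + j)) · bin) K
    S₁ S₂ : ℤ
    S₁ = sumFrom1 (suc K) (λ j → sign j ℤ.* + shiftedBinom (suc n) K (c * pent j + c * j))
    S₂ = sumFrom1 (suc K) (λ j → sign j ℤ.* + shiftedBinom (suc n) K (c * pent j))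
    j≤c*pent : ∀ j → j ≤ c * pent j
    j≤c*pent j = ≤-trans (j≤pent j) (m≤n*m (pent j) c {{>-nonZero c≥1}})

theorem3p4 : (n c k : ℕ) → 1 ≤ n → 1 ≤ c → k ≤ n → + ic c n k ≡ rhs c n k
theorem3p4 (suc n) c k _ c≥1 k≤n = begin
  + ic c (suc n) k                               ≡⟨ icSeries≗poch (suc n) k ⟩
  poch 0 (suc n) (binomials (suc n)) k           ≡⟨ shanksSum≡poch (suc n) (binomials (suc n)) k k≤n ⟨
  shanksSum (suc n) (binomials (suc n)) k        ≡⟨ shanks (suc n) (binomials (suc n)) k ⟩
  pentagonalSum (suc n) (binomials (suc n)) k    ≡⟨ pentagonalSum≡rhs n k k≤n ⟩
  rhs c (suc n) k                                ∎
  where open Coloured c c≥1
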